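{- If $\mathcal{A}$ is any collection of $r>2$ pairwise disjoint lines in $\mathbf{P}^3$, then $I_{\mathcal{A}}$ is not generated by products of linear forms.
   Context: $k$ is an infinite field and $I_{\mathcal{A}}\subseteq k[x_0,x_1,x_2,x_3]$ is the homogeneous ideal of polynomials vanishing on the union of the lines in $\mathcal{A}$ (the intersection of the linear ideals defining the lines). -}

module Defs where

open import Level using (Level; _⊔_; suc)
open import Algebra.Bundles using (CommutativeRing)
open import Data.Nat using (ℕ; zero)
open import Data.Fin using (Fin)
open import Data.Vec using (Vec; []; _∷_; zipWith; foldr)
import Data.Vec
open import Data.List.Relation.Unary.All using (All)
open import Data.Vec.Properties using (≡-dec)
import Data.Nat.Properties as ℕP
open import Data.List as List using (List; []; _∷_; _++_; length)
open import Data.Product using (Σ; ∃; _×_; _,_)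
open import Relation.Nullary using (¬_; yes; no)
open import Relation.Binary.PropositionalEquality using (_≡_)

record Field (c ℓ : Level) : Set (suc (c ⊔ ℓ)) where
  field
    commRing : CommutativeRing c ℓ
  open CommutativeRing commRing public
  field
    1≉0     : ¬ (1# ≈ 0#)
    inverse : ∀ x → ¬ (x ≈ 0#) → Σ Carrier λ y → x * y ≈ 1#

Infinite : ∀ {c ℓ} → Field c ℓ → Set (c ⊔ ℓ)
Infinite F = Σ (ℕ → Carrier) λ f → ∀ m n → f m ≈ f n → m ≡ n
  where open Field F

module _ {c ℓ} (F : Field c ℓ) where
  open Field F

  -- A monomial is its exponent vector; a polynomial is a finite list of
  -- terms (coefficient, monomial); two polynomials are equal when all
  -- their coefficients agree.

  Monomial : Set
  Monomial = Vec ℕ 4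

  Poly : Set c
  Poly = List (Carrier × Monomial)

  coeff : Poly → Monomial → Carrier
  coeff []              m = 0#
  coeff ((a , e) ∷ p)   m with ≡-dec ℕP._≟_ e m
  ... | yes _ = a + coeff p m
  ... | no  _ = coeff p m

  _≈ₚ_ : Poly → Poly → Set ℓ
  p ≈ₚ q = ∀ m → coeff p m ≈ coeff q m

  0ₚ : Poly
  0ₚ = []

  1ₚ : Poly
  1ₚ = (1# , (0 ∷ 0 ∷ 0 ∷ 0 ∷ [])) ∷ []

  _+ₚ_ : Poly → Poly → Poly
  p +ₚ q = p ++ q

  _*ₚ_ : Poly → Poly → Poly
  p *ₚ q = List.concatMap (λ { (a , e) → List.map (λ { (b , f) → (a * b , zipWith ℕ._+_ e f) }) q }) p
    where import Data.Nat as ℕ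

  sumₚ : List Poly → Poly
  sumₚ = List.foldr _+ₚ_ 0ₚ

  productₚ : List Poly → Poly
  productₚ = List.foldr _*ₚ_ 1ₚ

  LinearForm : Set c
  LinearForm = Vec Carrier 4

  linPoly : LinearForm → Poly
  linPoly (a₀ ∷ a₁ ∷ a₂ ∷ a₃ ∷ []) =
      (a₀ , (1 ∷ 0 ∷ 0 ∷ 0 ∷ []))
    ∷ (a₁ , (0 ∷ 1 ∷ 0 ∷ 0 ∷ []))
    ∷ (a₂ , (0 ∷ 0 ∷ 1 ∷ 0 ∷ []))
    ∷ (a₃ , (0 ∷ 0 ∷ 0 ∷ 1 ∷ []))
    ∷ []

  evalLin : LinearForm → Vec Carrier 4 → Carrier
  evalLin l x = foldr _ _+_ 0# (zipWith _*_ l x)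

  IsZeroVec : Vec Carrier 4 → Set ℓ
  IsZeroVec (a₀ ∷ a₁ ∷ a₂ ∷ a₃ ∷ []) = (a₀ ≈ 0#) × (a₁ ≈ 0#) × (a₂ ≈ 0#) × (a₃ ≈ 0#)

  -- A line in P³ is the zero set of two linearly independent linear
  -- forms; its (linear) ideal is generated by them.

  record Line : Set (c ⊔ ℓ) where
    field
      form₁ form₂ : LinearForm
      independent : ∀ a b →
        IsZeroVec (zipWith _+_ (Data.Vec.map (a *_) form₁) (Data.Vec.map (b *_) form₂)) →
        (a ≈ 0#) × (b ≈ 0#)
  open Line public

  -- Two lines are disjoint in P³: their linear forms have no common
  -- nonzero zero in k⁴.
  Disjoint : Line → Line → Set (c ⊔ ℓ)
  Disjoint L M = ∀ (x : Vec Carrier 4) →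
    evalLin (form₁ L) x ≈ 0# → evalLin (form₂ L) x ≈ 0# →
    evalLin (form₁ M) x ≈ 0# → evalLin (form₂ M) x ≈ 0# →
    IsZeroVec x

  InIdealGen : List Poly → Poly → Set (c ⊔ ℓ)
  InIdealGen gs f = Σ (List Poly) λ hs →
    (length hs ≡ length gs) × (f ≈ₚ sumₚ (List.zipWith _*ₚ_ hs gs))

  InLineIdeal : Line → Poly → Set (c ⊔ ℓ)
  InLineIdeal L = InIdealGen (linPoly (form₁ L) ∷ linPoly (form₂ L) ∷ [])

  I_ : ∀ {r} → (Fin r → Line) → Poly → Set (c ⊔ ℓ)
  I_ A f = ∀ i → InLineIdeal (A i) f

  IsProductOfLinearForms : Poly → Set (c ⊔ ℓ)
  IsProductOfLinearForms p =
    Σ (List LinearForm) λ ls → p ≈ₚ productₚ (List.map linPoly ls)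

  -- an ideal (given by its membership predicate) is generated by
  -- products of linear forms: it equals the ideal generated by some
  -- finite list of products of linear forms.
  -- (Finiteness is harmless: k[x₀..x₃] is Noetherian.)
  GeneratedByProductsOfLinearForms : (Poly → Set (c ⊔ ℓ)) → Set (c ⊔ ℓ)
  GeneratedByProductsOfLinearForms J =
    Σ (List Poly) λ gs →
      All IsProductOfLinearForms gs
      × (∀ f → J f → InIdealGen gs f)
      × (∀ f → InIdealGen gs f → J f)

{-# OPTIONS --safe #-}

-- A product of linear forms lying in I_𝒜 is either zero or of degree at least r. Indeed it
-- vanishes on every line of 𝒜; a line is irreducible (over an infinite field a generic point of
-- it makes all non-vanishing factors nonzero), so each line has a factor vanishing on it; and no
-- nonzero linear form vanishes on two disjoint lines. Hence no element of the ideal generated by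
-- such products has terms of degree < r. But I_𝒜 contains a nonzero form of degree r - 1: the
-- quadric through three of the lines times one linear form through each remaining line.
-- Equality in k need not be decidable, so existence statements are double negated; this is
-- harmless for a negative conclusion.

module Submission where

open import Level using (Level; _⊔_)
open import Algebra.Bundles using (CommutativeRing)
import Algebra.Solver.Ring
import Algebra.Solver.Ring.AlmostCommutativeRing as ACR
open import Data.Empty using (⊥; ⊥-elim)
open import Data.Fin as Fin using (Fin)
import Data.Fin.Properties as Fin
open import Data.Integer as ℤ using (ℤ; 0ℤ; 1ℤ)
import Data.Integer.Properties as ℤ
open import Data.List as List using (List; []; _∷_; _++_; length)
open import Data.List.Membership.Propositional using (_∈_; find)
open import Data.List.Membership.Propositional.Properties using (∈-∃++; ∈-tabulate⁺)
import Data.List.Properties as List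
open import Data.List.Relation.Unary.All as All using (All; []; _∷_)
import Data.List.Relation.Unary.All.Properties as All
open import Data.List.Relation.Unary.Any as Any using (Any; here; there)
import Data.List.Relation.Unary.Any.Properties as Any
open import Data.Maybe as Maybe using (Maybe)
open import Data.Nat as ℕ using (ℕ; zero; suc; _<_; _≤_)
import Data.Nat.Properties as ℕ
open import Data.Product using (Σ; _×_; _,_; proj₁; proj₂)
open import Data.Sign as Sign using (Sign)
open import Data.Sum using (_⊎_; inj₁; inj₂)
open import Data.Unit using (⊤; tt)
open import Data.Vec as Vec using (Vec; []; _∷_; zipWith)
open import Data.Vec.Properties using (≡-dec; zipWith-comm; zipWith-assoc; ∷-injective)
open import Data.Vec.Relation.Binary.Pointwise.Inductive using (Pointwise; []; _∷_)
open import Function using (_∘_; case_of_)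
open import Relation.Binary.PropositionalEquality as ≡ using (_≡_; _≢_)
open import Relation.Binary.Structures using (IsEquivalence)
open import Relation.Nullary using (¬_; yes; no)
open import Relation.Nullary.Decidable using (¬¬-excluded-middle; dec⇒maybe)
open import Relation.Nullary.Negation using (contradiction)
open import Defs

private
  variable
    a b : Level
    A : Set a
    B : Set b

_>>=_ : ¬ ¬ A → (A → ¬ ¬ B) → ¬ ¬ B
(¬¬a >>= f) ¬b = ¬¬a (λ a → f a ¬b)

return : A → ¬ ¬ A
return = contradiction

¬¬⊥⇒⊥ : ¬ ¬ ⊥ → ⊥
¬¬⊥⇒⊥ ¬¬⊥ = ¬¬⊥ λ ()

¬¬-All : ∀ {p} {P : A → Set p} {xs} → All (λ x → ¬ ¬ P x) xs → ¬ ¬ All P xs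
¬¬-All [] = return []
¬¬-All (¬¬px ∷ ¬¬pxs) = do
  px ← ¬¬px
  pxs ← ¬¬-All ¬¬pxs
  return (px ∷ pxs)

¬¬-Π-Fin : ∀ n {p} {P : Fin n → Set p} → (∀ i → ¬ ¬ P i) → ¬ ¬ (∀ i → P i)
¬¬-Π-Fin zero _ = return λ ()
¬¬-Π-Fin (suc n) ¬¬P = do
  P₀ ← ¬¬P Fin.zero
  P₊ ← ¬¬-Π-Fin n (¬¬P ∘ Fin.suc)
  return λ { Fin.zero → P₀ ; (Fin.suc i) → P₊ i }

-- Every commutative ring is a ℤ-algebra, which lets Algebra.Solver.Ring work with decidable
-- integer coefficients.
module CommutativeRingSolver {c ℓ} (R : CommutativeRing c ℓ) where
  open import Data.Integer using (+_; -[1+_]; _⊖_; _◃_; sign; ∣_∣)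
  open CommutativeRing R
  open import Algebra.Properties.Semiring.Mult.TCOptimised semiring using (×-homo-+; ×1-homo-*) renaming (_×_ to _×′_)
  open import Algebra.Properties.Group +-group using (⁻¹-involutive)
  open import Algebra.Properties.AbelianGroup +-abelianGroup using (⁻¹-∙-comm)
  open import Algebra.Properties.Ring ring using (-1*x≈-x; -0#≈0#)
  open import Algebra.Properties.CommutativeSemigroup +-commutativeSemigroup using (interchange)
  open import Algebra.Properties.CommutativeSemigroup *-commutativeSemigroup using () renaming (interchange to interchange-*)
  open import Relation.Binary.Reasoning.Setoid setoid

  -- With the optimised multiple, fromℤ (+ 1) reduces to 1#, so that con 1ℤ in a solver
  -- expression matches 1# in a goal.
  fromℤ : ℤ → Carrier
  fromℤ (+ n) = n ×′ 1#
  fromℤ (-[1+ n ]) = - (suc n ×′ 1#)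

  fromℤ-homo-neg : ∀ i → fromℤ (ℤ.- i) ≈ - fromℤ i
  fromℤ-homo-neg (+ zero) = sym -0#≈0#
  fromℤ-homo-neg (+ suc n) = refl
  fromℤ-homo-neg -[1+ n ] = sym (⁻¹-involutive _)

  fromℤ-homo-⊖ : ∀ m n → fromℤ (m ⊖ n) ≈ m ×′ 1# - n ×′ 1#
  fromℤ-homo-⊖ zero zero = sym (-‿inverseʳ 0#)
  fromℤ-homo-⊖ zero (suc n) = sym (+-identityˡ _)
  fromℤ-homo-⊖ (suc m) zero = sym (trans (+-congˡ -0#≈0#) (+-identityʳ _))
  fromℤ-homo-⊖ (suc m) (suc n) = begin
    fromℤ (suc m ⊖ suc n)               ≡⟨ ≡.cong fromℤ (ℤ.[1+m]⊖[1+n]≡m⊖n m n) ⟩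
    fromℤ (m ⊖ n)                       ≈⟨ fromℤ-homo-⊖ m n ⟩
    m ×′ 1# - n ×′ 1#                   ≈⟨ +-identityˡ _ ⟨
    0# + (m ×′ 1# - n ×′ 1#)            ≈⟨ +-congʳ (-‿inverseʳ 1#) ⟨
    (1# - 1#) + (m ×′ 1# - n ×′ 1#)     ≈⟨ interchange 1# _ _ _ ⟩
    (1# + m ×′ 1#) + (- 1# - n ×′ 1#)   ≈⟨ +-congˡ (⁻¹-∙-comm 1# _) ⟩
    (1# + m ×′ 1#) - (1# + n ×′ 1#)     ≈⟨ +-cong (×-homo-+ 1# 1 m) (-‿cong (×-homo-+ 1# 1 n)) ⟨
    suc m ×′ 1# - suc n ×′ 1#           ∎

  fromℤ-homo-+ : ∀ i j → fromℤ (i ℤ.+ j) ≈ fromℤ i + fromℤ j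
  fromℤ-homo-+ (+ m) (+ n) = ×-homo-+ 1# m n
  fromℤ-homo-+ (+ m) -[1+ n ] = fromℤ-homo-⊖ m (suc n)
  fromℤ-homo-+ -[1+ m ] (+ n) = trans (fromℤ-homo-⊖ n (suc m)) (+-comm _ _)
  fromℤ-homo-+ -[1+ m ] -[1+ n ] = begin
    - (suc (suc (m ℕ.+ n)) ×′ 1#)    ≡⟨ ≡.cong (λ k → - (suc k ×′ 1#)) (ℕ.+-suc m n) ⟨
    - ((suc m ℕ.+ suc n) ×′ 1#)      ≈⟨ -‿cong (×-homo-+ 1# (suc m) (suc n)) ⟩
    - (suc m ×′ 1# + suc n ×′ 1#)    ≈⟨ ⁻¹-∙-comm _ _ ⟨
    - (suc m ×′ 1#) - (suc n ×′ 1#)  ∎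

  σ : Sign → Carrier
  σ Sign.+ = 1#
  σ Sign.- = - 1#

  σ-homo : ∀ s t → σ (s Sign.* t) ≈ σ s * σ t
  σ-homo Sign.+ t = sym (*-identityˡ _)
  σ-homo Sign.- Sign.+ = sym (*-identityʳ _)
  σ-homo Sign.- Sign.- = sym (trans (-1*x≈-x _) (⁻¹-involutive _))

  fromℤ-◃ : ∀ s n → fromℤ (s ◃ n) ≈ σ s * n ×′ 1#
  fromℤ-◃ s zero = sym (zeroʳ _)
  fromℤ-◃ Sign.+ (suc n) = sym (*-identityˡ _)
  fromℤ-◃ Sign.- (suc n) = sym (-1*x≈-x _)

  fromℤ-signAbs : ∀ i → fromℤ i ≈ σ (sign i) * ∣ i ∣ ×′ 1#
  fromℤ-signAbs i = trans (reflexive (≡.cong fromℤ (≡.sym (ℤ.◃-inverse i)))) (fromℤ-◃ (sign i) ∣ i ∣)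

  fromℤ-homo-* : ∀ i j → fromℤ (i ℤ.* j) ≈ fromℤ i * fromℤ j
  fromℤ-homo-* i j = begin
    fromℤ (sign i Sign.* sign j ◃ ∣ i ∣ ℕ.* ∣ j ∣)               ≈⟨ fromℤ-◃ (sign i Sign.* sign j) (∣ i ∣ ℕ.* ∣ j ∣) ⟩
    σ (sign i Sign.* sign j) * (∣ i ∣ ℕ.* ∣ j ∣) ×′ 1#           ≈⟨ *-cong (σ-homo (sign i) (sign j)) (×1-homo-* ∣ i ∣ ∣ j ∣) ⟩
    (σ (sign i) * σ (sign j)) * (∣ i ∣ ×′ 1# * ∣ j ∣ ×′ 1#)      ≈⟨ interchange-* _ _ _ _ ⟩
    (σ (sign i) * ∣ i ∣ ×′ 1#) * (σ (sign j) * ∣ j ∣ ×′ 1#)      ≈⟨ *-cong (fromℤ-signAbs i) (fromℤ-signAbs j) ⟨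
    fromℤ i * fromℤ j                                              ∎

  integerHomomorphism : ℤ.+-*-rawRing ACR.-Raw-AlmostCommutative⟶ ACR.fromCommutativeRing R
  integerHomomorphism = record
    { ⟦_⟧ = fromℤ ; +-homo = fromℤ-homo-+ ; *-homo = fromℤ-homo-* ; -‿homo = fromℤ-homo-neg
    ; 0-homo = refl ; 1-homo = refl }

  fromℤ-≟ : ∀ i j → Maybe (fromℤ i ≈ fromℤ j)
  fromℤ-≟ i j = Maybe.map (λ { ≡.refl → refl }) (dec⇒maybe (i ℤ.≟ j))

  open Algebra.Solver.Ring ℤ.+-*-rawRing (ACR.fromCommutativeRing R) integerHomomorphism fromℤ-≟
    public using (solve; _:=_; _:+_; _:*_; _:-_; :-_; con; Polynomial)

module ListSums {c ℓ} (R : CommutativeRing c ℓ) where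
  open CommutativeRing R
  open CommutativeRingSolver R
  open import Algebra.Properties.Ring ring using (-0#≈0#)
  open import Algebra.Properties.AbelianGroup +-abelianGroup using (⁻¹-∙-comm)

  ∑ : List A → (A → Carrier) → Carrier
  ∑ [] f = 0#
  ∑ (x ∷ xs) f = f x + ∑ xs f

  infix 5 ∑
  syntax ∑ xs (λ x → e) = ∑[ x ∈ xs ] e

  ∑-cong : ∀ (xs : List A) {f g} → (∀ x → f x ≈ g x) → ∑ xs f ≈ ∑ xs g
  ∑-cong [] f≈g = refl
  ∑-cong (x ∷ xs) f≈g = +-cong (f≈g x) (∑-cong xs f≈g)

  ∑-++ : ∀ (xs ys : List A) f → ∑ (xs ++ ys) f ≈ ∑ xs f + ∑ ys f
  ∑-++ [] ys f = sym (+-identityˡ _)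
  ∑-++ (x ∷ xs) ys f = trans (+-congˡ (∑-++ xs ys f)) (sym (+-assoc _ _ _))

  ∑-zero : ∀ (xs : List A) → (∑[ x ∈ xs ] 0#) ≈ 0#
  ∑-zero [] = refl
  ∑-zero (x ∷ xs) = trans (+-congˡ (∑-zero xs)) (+-identityʳ 0#)

  ∑-+ : ∀ (xs : List A) f g → (∑[ x ∈ xs ] f x + g x) ≈ ∑ xs f + ∑ xs g
  ∑-+ [] f g = sym (+-identityˡ _)
  ∑-+ (x ∷ xs) f g = trans (+-congˡ (∑-+ xs f g))
    (solve 4 (λ a b c d → (a :+ b) :+ (c :+ d) := (a :+ c) :+ (b :+ d)) refl _ _ _ _)

  ∑-*ˡ : ∀ (xs : List A) k f → (∑[ x ∈ xs ] k * f x) ≈ k * ∑ xs f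
  ∑-*ˡ [] k f = sym (zeroʳ k)
  ∑-*ˡ (x ∷ xs) k f = trans (+-congˡ (∑-*ˡ xs k f)) (sym (distribˡ k _ _))

  ∑-*ʳ : ∀ (xs : List A) k f → (∑[ x ∈ xs ] f x * k) ≈ ∑ xs f * k
  ∑-*ʳ xs k f = trans (∑-cong xs (λ x → *-comm _ _)) (trans (∑-*ˡ xs k f) (*-comm _ _))

  ∑-neg : ∀ (xs : List A) f → (∑[ x ∈ xs ] - f x) ≈ - ∑ xs f
  ∑-neg [] f = sym -0#≈0#
  ∑-neg (x ∷ xs) f = trans (+-congˡ (∑-neg xs f)) (⁻¹-∙-comm _ _)

  ∑-map : ∀ (h : B → A) xs f → ∑ (List.map h xs) f ≡ ∑ xs (f ∘ h)
  ∑-map h [] f = ≡.refl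
  ∑-map h (x ∷ xs) f = ≡.cong (f (h x) +_) (∑-map h xs f)

  ∑-concatMap : ∀ (h : B → List A) xs f →
    ∑ (List.concatMap h xs) f ≈ (∑[ x ∈ xs ] ∑ (h x) f)
  ∑-concatMap h [] f = refl
  ∑-concatMap h (x ∷ xs) f = trans (∑-++ (h x) _ f) (+-congˡ (∑-concatMap h xs f))

  ∑-comm : ∀ (xs : List A) (ys : List B) (f : A → B → Carrier) →
    (∑[ x ∈ xs ] ∑[ y ∈ ys ] f x y) ≈ (∑[ y ∈ ys ] ∑[ x ∈ xs ] f x y)
  ∑-comm [] ys f = sym (∑-zero ys)
  ∑-comm (x ∷ xs) ys f = trans (+-congˡ (∑-comm xs ys f)) (sym (∑-+ ys (f x) (λ y → ∑[ x′ ∈ xs ] f x′ y)))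

infixl 6 _⊕_
_⊕_ : ∀ {n} → Vec ℕ n → Vec ℕ n → Vec ℕ n
_⊕_ = zipWith ℕ._+_

⊕-cancelˡ : ∀ {n} (e : Vec ℕ n) {f g} → e ⊕ f ≡ e ⊕ g → f ≡ g
⊕-cancelˡ [] {[]} {[]} _ = ≡.refl
⊕-cancelˡ (x ∷ e) {y ∷ f} {z ∷ g} eq =
  let x+y≡x+z , e⊕f≡e⊕g = ∷-injective eq
  in ≡.cong₂ _∷_ (ℕ.+-cancelˡ-≡ x y z x+y≡x+z) (⊕-cancelˡ e e⊕f≡e⊕g)

⊕-∸-inverse : ∀ {n} (e f : Vec ℕ n) → zipWith ℕ._∸_ (e ⊕ f) e ≡ f
⊕-∸-inverse [] [] = ≡.refl
⊕-∸-inverse (x ∷ e) (y ∷ f) = ≡.cong₂ _∷_ (ℕ.m+n∸m≡n x y) (⊕-∸-inverse e f)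

_∣?_ : ∀ {n} (e m : Vec ℕ n) → (Σ (Vec ℕ n) λ m′ → e ⊕ m′ ≡ m) ⊎ (∀ m′ → e ⊕ m′ ≢ m)
e ∣? m with ≡-dec ℕ._≟_ (e ⊕ zipWith ℕ._∸_ m e) m
... | yes eq = inj₁ (_ , eq)
... | no ¬eq = inj₂ λ { m′ ≡.refl → ¬eq (≡.cong (e ⊕_) (⊕-∸-inverse e m′)) }

⊕-comm : ∀ {n} (e f : Vec ℕ n) → e ⊕ f ≡ f ⊕ e
⊕-comm = zipWith-comm ℕ.+-comm

⊕-assoc : ∀ {n} (e f g : Vec ℕ n) → e ⊕ f ⊕ g ≡ e ⊕ (f ⊕ g)
⊕-assoc = zipWith-assoc ℕ.+-assoc

⊕-identityˡ : ∀ {n} (f : Vec ℕ n) → Vec.replicate n 0 ⊕ f ≡ f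
⊕-identityˡ [] = ≡.refl
⊕-identityˡ (x ∷ f) = ≡.cong (x ∷_) (⊕-identityˡ f)

degree : ∀ {n} → Vec ℕ n → ℕ
degree = Vec.sum

degree-⊕ : ∀ {n} (e f : Vec ℕ n) → degree (e ⊕ f) ≡ degree e ℕ.+ degree f
degree-⊕ [] [] = ≡.refl
degree-⊕ (x ∷ e) (y ∷ f) = ≡.trans (≡.cong ((x ℕ.+ y) ℕ.+_) (degree-⊕ e f)) (ℕ-interchange x y _ _)
  where open import Algebra.Properties.CommutativeSemigroup ℕ.+-commutativeSemigroup
          using () renaming (interchange to ℕ-interchange)

module Polynomials {c ℓ} (F : Field c ℓ) where
  open Field F hiding (zero)
  open CommutativeRingSolver commRing
  open ListSums commRing
  open import Algebra.Properties.Ring ring using (-0#≈0#; -‿distribˡ-*)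
  open import Relation.Binary.Reasoning.Setoid setoid

  Term : Set c
  Term = Carrier × Monomial F

  _·ₜ_ : Term → Term → Term
  (a , e) ·ₜ (b , f) = (a * b , e ⊕ f)

  termCoeff : Term → Monomial F → Carrier
  termCoeff (a , e) m with ≡-dec ℕ._≟_ e m
  ... | yes _ = a
  ... | no  _ = 0#

  termCoeff-self : ∀ a e → termCoeff (a , e) e ≈ a
  termCoeff-self a e with ≡-dec ℕ._≟_ e e
  ... | yes _ = refl
  ... | no e≢e = ⊥-elim (e≢e ≡.refl)

  termCoeff-≢ : ∀ a {e m} → e ≢ m → termCoeff (a , e) m ≈ 0#
  termCoeff-≢ a {e} {m} e≢m with ≡-dec ℕ._≟_ e m
  ... | yes e≡m = ⊥-elim (e≢m e≡m)
  ... | no  _ = refl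

  termCoeff-cong : ∀ {a b e f} m → a ≈ b → e ≡ f → termCoeff (a , e) m ≈ termCoeff (b , f) m
  termCoeff-cong {e = e} m a≈b ≡.refl with ≡-dec ℕ._≟_ e m
  ... | yes _ = a≈b
  ... | no  _ = refl

  termCoeff-≈0 : ∀ {a} e m → a ≈ 0# → termCoeff (a , e) m ≈ 0#
  termCoeff-≈0 e m a≈0 with ≡-dec ℕ._≟_ e m
  ... | yes _ = a≈0
  ... | no  _ = refl

  termCoeff-*ˡ : ∀ k a e m → termCoeff (k * a , e) m ≈ k * termCoeff (a , e) m
  termCoeff-*ˡ k a e m with ≡-dec ℕ._≟_ e m
  ... | yes _ = refl
  ... | no  _ = sym (zeroʳ k)

  termCoeff-neg : ∀ a e m → termCoeff (- a , e) m ≈ - termCoeff (a , e) m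
  termCoeff-neg a e m with ≡-dec ℕ._≟_ e m
  ... | yes _ = refl
  ... | no  _ = sym -0#≈0#

  coeff-∷ : ∀ t p m → coeff F (t ∷ p) m ≈ termCoeff t m + coeff F p m
  coeff-∷ (a , e) p m with ≡-dec ℕ._≟_ e m
  ... | yes _ = refl
  ... | no  _ = sym (+-identityˡ _)

  coeff≈∑ : ∀ p m → coeff F p m ≈ (∑[ t ∈ p ] termCoeff t m)
  coeff≈∑ [] m = refl
  coeff≈∑ (t ∷ p) m = trans (coeff-∷ t p m) (+-congˡ (coeff≈∑ p m))

  coeff-≈0 : ∀ {p} m → All (λ t → proj₁ t ≈ 0#) p → coeff F p m ≈ 0#
  coeff-≈0 m [] = refl
  coeff-≈0 {(a , e) ∷ p} m (a≈0 ∷ p≈0) =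
    trans (coeff-∷ (a , e) p m) (trans (+-cong (termCoeff-≈0 e m a≈0) (coeff-≈0 m p≈0)) (+-identityˡ 0#))

  coeff-++ : ∀ p q m → coeff F (p ++ q) m ≈ coeff F p m + coeff F q m
  coeff-++ p q m = begin
    coeff F (p ++ q) m                ≈⟨ coeff≈∑ (p ++ q) m ⟩
    ∑[ t ∈ p ++ q ] termCoeff t m     ≈⟨ ∑-++ p q _ ⟩
    (∑[ t ∈ p ] termCoeff t m) + (∑[ t ∈ q ] termCoeff t m) ≈⟨ +-cong (coeff≈∑ p m) (coeff≈∑ q m) ⟨
    coeff F p m + coeff F q m         ∎

  ∑-*ₚ : ∀ p q (g : Term → Carrier) → ∑ (_*ₚ_ F p q) g ≈ (∑[ s ∈ p ] ∑[ t ∈ q ] g (s ·ₜ t))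
  ∑-*ₚ p q g = trans (∑-concatMap _ p g) (∑-cong p (λ s → reflexive (∑-map (s ·ₜ_) q g)))

  coeff-*ₚ : ∀ p q m → coeff F (_*ₚ_ F p q) m ≈ (∑[ s ∈ p ] ∑[ t ∈ q ] termCoeff (s ·ₜ t) m)
  coeff-*ₚ p q m = trans (coeff≈∑ (_*ₚ_ F p q) m) (∑-*ₚ p q _)

  termCoeff-⊕ : ∀ a e f m′ → termCoeff (a , e ⊕ f) (e ⊕ m′) ≈ termCoeff (a , f) m′
  termCoeff-⊕ a e f m′ with ≡-dec ℕ._≟_ f m′
  ... | yes ≡.refl = termCoeff-self a (e ⊕ f)
  ... | no f≢m′ = termCoeff-≢ a (f≢m′ ∘ ⊕-cancelˡ e)

  termTimes : Term → Poly F → Poly F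
  termTimes s = List.map (s ·ₜ_)

  coeff-termTimes-∣ : ∀ a e q m′ → coeff F (termTimes (a , e) q) (e ⊕ m′) ≈ a * coeff F q m′
  coeff-termTimes-∣ a e q m′ = begin
    coeff F (termTimes (a , e) q) (e ⊕ m′)              ≈⟨ coeff≈∑ (termTimes (a , e) q) _ ⟩
    ∑ (termTimes (a , e) q) (λ t → termCoeff t (e ⊕ m′)) ≡⟨ ∑-map _ q _ ⟩
    ∑[ t ∈ q ] termCoeff ((a , e) ·ₜ t) (e ⊕ m′)          ≈⟨ ∑-cong q (λ (b , f) → termCoeff-*ˡ a b (e ⊕ f) _) ⟩
    ∑[ t ∈ q ] a * termCoeff (proj₁ t , e ⊕ proj₂ t) (e ⊕ m′) ≈⟨ ∑-*ˡ q a _ ⟩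
    a * (∑[ t ∈ q ] termCoeff (proj₁ t , e ⊕ proj₂ t) (e ⊕ m′)) ≈⟨ *-congˡ (∑-cong q (λ (b , f) → termCoeff-⊕ b e f m′)) ⟩
    a * (∑[ t ∈ q ] termCoeff t m′)                      ≈⟨ *-congˡ (coeff≈∑ q m′) ⟨
    a * coeff F q m′                                     ∎

  coeff-termTimes-∤ : ∀ a e q m → (∀ m′ → e ⊕ m′ ≢ m) → coeff F (termTimes (a , e) q) m ≈ 0#
  coeff-termTimes-∤ a e q m e∤m = begin
    coeff F (termTimes (a , e) q) m              ≈⟨ coeff≈∑ (termTimes (a , e) q) _ ⟩
    ∑ (termTimes (a , e) q) (λ t → termCoeff t m) ≡⟨ ∑-map _ q _ ⟩
    ∑[ t ∈ q ] termCoeff ((a , e) ·ₜ t) m         ≈⟨ ∑-cong q (λ (b , f) → termCoeff-≢ (a * b) (e∤m f)) ⟩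
    ∑[ t ∈ q ] 0#                                ≈⟨ ∑-zero q ⟩
    0#                                           ∎

  -- _≈ₚ_ unfolds to a function type from which the polynomials cannot be inferred.
  infix 4 _≃_
  record _≃_ (p q : Poly F) : Set ℓ where
    constructor mk≃
    field coeffwise : _≈ₚ_ F p q
  open _≃_ public

  termTimes-cong : ∀ s {q q′} → q ≃ q′ → termTimes s q ≃ termTimes s q′
  termTimes-cong (a , e) {q} {q′} (mk≃ q≈q′) = mk≃ coefficientwise
    where
    coefficientwise : ∀ m → coeff F (termTimes (a , e) q) m ≈ coeff F (termTimes (a , e) q′) m
    coefficientwise m with e ∣? m
    ... | inj₁ (m′ , ≡.refl) = trans (coeff-termTimes-∣ a e q m′) (trans (*-congˡ (q≈q′ m′)) (sym (coeff-termTimes-∣ a e q′ m′)))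
    ... | inj₂ e∤m = trans (coeff-termTimes-∤ a e q m e∤m) (sym (coeff-termTimes-∤ a e q′ m e∤m))

  *ₚ-congʳ : ∀ p {q q′} → q ≃ q′ → _*ₚ_ F p q ≃ _*ₚ_ F p q′
  *ₚ-congʳ [] q≃q′ = mk≃ λ m → refl
  *ₚ-congʳ (s ∷ p) {q} {q′} q≃q′ = mk≃ λ m → begin
    coeff F (termTimes s q ++ _*ₚ_ F p q) m                    ≈⟨ coeff-++ (termTimes s q) _ m ⟩
    coeff F (termTimes s q) m + coeff F (_*ₚ_ F p q) m        ≈⟨ +-cong (coeffwise (termTimes-cong s q≃q′) m) (coeffwise (*ₚ-congʳ p q≃q′) m) ⟩
    coeff F (termTimes s q′) m + coeff F (_*ₚ_ F p q′) m      ≈⟨ coeff-++ (termTimes s q′) _ m ⟨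
    coeff F (termTimes s q′ ++ _*ₚ_ F p q′) m                  ∎

  *ₚ-comm : ∀ p q → _*ₚ_ F p q ≃ _*ₚ_ F q p
  *ₚ-comm p q = mk≃ λ m → begin
    coeff F (_*ₚ_ F p q) m                              ≈⟨ coeff-*ₚ p q m ⟩
    (∑[ s ∈ p ] ∑[ t ∈ q ] termCoeff (s ·ₜ t) m)       ≈⟨ ∑-comm p q _ ⟩
    (∑[ t ∈ q ] ∑[ s ∈ p ] termCoeff (s ·ₜ t) m)       ≈⟨ ∑-cong q (λ (b , f) → ∑-cong p (λ (a , e) → termCoeff-cong m (*-comm a b) (⊕-comm e f))) ⟩
    (∑[ t ∈ q ] ∑[ s ∈ p ] termCoeff (t ·ₜ s) m)       ≈⟨ coeff-*ₚ q p m ⟨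
    coeff F (_*ₚ_ F q p) m                              ∎

  *ₚ-assoc : ∀ p q r → _*ₚ_ F (_*ₚ_ F p q) r ≃ _*ₚ_ F p (_*ₚ_ F q r)
  *ₚ-assoc p q r = mk≃ λ m → begin
    coeff F (_*ₚ_ F (_*ₚ_ F p q) r) m                                  ≈⟨ coeff-*ₚ (_*ₚ_ F p q) r m ⟩
    (∑[ u ∈ _*ₚ_ F p q ] ∑[ w ∈ r ] termCoeff (u ·ₜ w) m)             ≈⟨ ∑-*ₚ p q _ ⟩
    (∑[ s ∈ p ] ∑[ t ∈ q ] ∑[ w ∈ r ] termCoeff ((s ·ₜ t) ·ₜ w) m)    ≈⟨ ∑-cong p (λ (a , e) → ∑-cong q (λ (b , f) → ∑-cong r (λ (c , g) →
                                                                          termCoeff-cong m (*-assoc a b c) (⊕-assoc e f g)))) ⟩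
    (∑[ s ∈ p ] ∑[ t ∈ q ] ∑[ w ∈ r ] termCoeff (s ·ₜ (t ·ₜ w)) m)    ≈⟨ ∑-cong p (λ s → ∑-*ₚ q r (λ v → termCoeff (s ·ₜ v) m)) ⟨
    (∑[ s ∈ p ] ∑[ v ∈ _*ₚ_ F q r ] termCoeff (s ·ₜ v) m)             ≈⟨ coeff-*ₚ p (_*ₚ_ F q r) m ⟨
    coeff F (_*ₚ_ F p (_*ₚ_ F q r)) m                                  ∎

  *ₚ-identityˡ : ∀ p → _*ₚ_ F (1ₚ F) p ≃ p
  *ₚ-identityˡ p = mk≃ λ m → begin
    coeff F (_*ₚ_ F (1ₚ F) p) m                        ≈⟨ coeff-*ₚ (1ₚ F) p m ⟩
    (∑[ t ∈ p ] termCoeff ((1# , Vec.replicate 4 0) ·ₜ t) m) + 0# ≈⟨ +-identityʳ _ ⟩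
    (∑[ t ∈ p ] termCoeff ((1# , Vec.replicate 4 0) ·ₜ t) m)      ≈⟨ ∑-cong p (λ (b , f) → termCoeff-cong m (*-identityˡ b) (⊕-identityˡ f)) ⟩
    (∑[ t ∈ p ] termCoeff t m)                          ≈⟨ coeff≈∑ p m ⟨
    coeff F p m                                         ∎

  *ₚ-distribˡ : ∀ p q r → _*ₚ_ F p (q ++ r) ≃ _*ₚ_ F p q ++ _*ₚ_ F p r
  *ₚ-distribˡ p q r = mk≃ λ m → begin
    coeff F (_*ₚ_ F p (q ++ r)) m                                 ≈⟨ coeff-*ₚ p (q ++ r) m ⟩
    (∑[ s ∈ p ] ∑[ t ∈ q ++ r ] termCoeff (s ·ₜ t) m)             ≈⟨ ∑-cong p (λ s → ∑-++ q r _) ⟩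
    (∑[ s ∈ p ] (∑[ t ∈ q ] termCoeff (s ·ₜ t) m) + (∑[ t ∈ r ] termCoeff (s ·ₜ t) m)) ≈⟨ ∑-+ p _ _ ⟩
    (∑[ s ∈ p ] ∑[ t ∈ q ] termCoeff (s ·ₜ t) m) + (∑[ s ∈ p ] ∑[ t ∈ r ] termCoeff (s ·ₜ t) m) ≈⟨ +-cong (coeff-*ₚ p q m) (coeff-*ₚ p r m) ⟨
    coeff F (_*ₚ_ F p q) m + coeff F (_*ₚ_ F p r) m              ≈⟨ coeff-++ (_*ₚ_ F p q) _ m ⟨
    coeff F (_*ₚ_ F p q ++ _*ₚ_ F p r) m                          ∎

  -ₚ_ : Poly F → Poly F
  -ₚ_ = List.map (λ (a , e) → (- a , e))

  coeff-neg : ∀ p m → coeff F (-ₚ p) m ≈ - coeff F p m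
  coeff-neg p m = begin
    coeff F (-ₚ p) m                   ≈⟨ coeff≈∑ (-ₚ p) m ⟩
    ∑ (-ₚ p) (λ t → termCoeff t m)     ≡⟨ ∑-map _ p _ ⟩
    (∑[ (a , e) ∈ p ] termCoeff (- a , e) m) ≈⟨ ∑-cong p (λ (a , e) → termCoeff-neg a e m) ⟩
    (∑[ t ∈ p ] - termCoeff t m)       ≈⟨ ∑-neg p _ ⟩
    - (∑[ t ∈ p ] termCoeff t m)       ≈⟨ -‿cong (coeff≈∑ p m) ⟨
    - coeff F p m                      ∎

  ≃-isEquivalence : IsEquivalence _≃_
  ≃-isEquivalence = record
    { refl = mk≃ λ m → refl
    ; sym = λ (mk≃ p≈q) → mk≃ λ m → sym (p≈q m)
    ; trans = λ (mk≃ p≈q) (mk≃ q≈r) → mk≃ λ m → trans (p≈q m) (q≈r m)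
    }

  open IsEquivalence ≃-isEquivalence using () renaming (refl to ≃-refl; sym to ≃-sym; trans to ≃-trans)

  ++-cong : ∀ {p p′ q q′} → p ≃ p′ → q ≃ q′ → p ++ q ≃ p′ ++ q′
  ++-cong {p} {p′} {q} {q′} (mk≃ p≈p′) (mk≃ q≈q′) = mk≃ λ m →
    trans (coeff-++ p q m) (trans (+-cong (p≈p′ m) (q≈q′ m)) (sym (coeff-++ p′ q′ m)))

  ++-comm : ∀ p q → p ++ q ≃ q ++ p
  ++-comm p q = mk≃ λ m → trans (coeff-++ p q m) (trans (+-comm _ _) (sym (coeff-++ q p m)))

  -ₚ-cong : ∀ {p q} → p ≃ q → -ₚ p ≃ -ₚ q
  -ₚ-cong {p} {q} (mk≃ p≈q) = mk≃ λ m → trans (coeff-neg p m) (trans (-‿cong (p≈q m)) (sym (coeff-neg q m)))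

  -ₚ-inverseˡ : ∀ p → -ₚ p ++ p ≃ 0ₚ F
  -ₚ-inverseˡ p = mk≃ λ m → trans (coeff-++ (-ₚ p) p m) (trans (+-congʳ (coeff-neg p m)) (-‿inverseˡ _))

  -ₚ-inverseʳ : ∀ p → p ++ -ₚ p ≃ 0ₚ F
  -ₚ-inverseʳ p = ≃-trans (++-comm p (-ₚ p)) (-ₚ-inverseˡ p)

  *ₚ-cong : ∀ {p p′ q q′} → p ≃ p′ → q ≃ q′ → _*ₚ_ F p q ≃ _*ₚ_ F p′ q′
  *ₚ-cong {p} {p′} {q} {q′} p≃p′ q≃q′ =
    ≃-trans (*ₚ-congʳ p q≃q′) (≃-trans (*ₚ-comm p q′) (≃-trans (*ₚ-congʳ q′ p≃p′) (*ₚ-comm q′ p′)))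

  *ₚ-distribʳ : ∀ p q r → _*ₚ_ F (q ++ r) p ≃ _*ₚ_ F q p ++ _*ₚ_ F r p
  *ₚ-distribʳ p q r = ≃-trans (*ₚ-comm (q ++ r) p)
    (≃-trans (*ₚ-distribˡ p q r) (++-cong (*ₚ-comm p q) (*ₚ-comm p r)))

  polyRing : CommutativeRing c ℓ
  polyRing = record
    { Carrier = Poly F
    ; _≈_ = _≃_
    ; _+_ = _+ₚ_ F
    ; _*_ = _*ₚ_ F
    ; -_ = -ₚ_
    ; 0# = 0ₚ F
    ; 1# = 1ₚ F
    ; isCommutativeRing = record
      { isRing = record
        { +-isAbelianGroup = record
          { isGroup = record
            { isMonoid = record
              { isSemigroup = record
                { isMagma = record { isEquivalence = ≃-isEquivalence ; ∙-cong = ++-cong }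
                ; assoc = λ p q r → mk≃ λ m → reflexive (≡.cong (λ s → coeff F s m) (List.++-assoc p q r))
                }
              ; identity = (λ p → ≃-refl) , (λ p → mk≃ λ m → reflexive (≡.cong (λ s → coeff F s m) (List.++-identityʳ p)))
              }
            ; inverse = -ₚ-inverseˡ , -ₚ-inverseʳ
            ; ⁻¹-cong = -ₚ-cong
            }
          ; comm = ++-comm
          }
        ; *-cong = *ₚ-cong
        ; *-assoc = *ₚ-assoc
        ; *-identity = *ₚ-identityˡ , (λ p → ≃-trans (*ₚ-comm p (1ₚ F)) (*ₚ-identityˡ p))
        ; distrib = *ₚ-distribˡ , *ₚ-distribʳ
        }
      ; *-comm = *ₚ-comm
      }
    }

  open import Algebra.Properties.Semiring.Exp semiring using (_^_; ^-homo-*)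

  monomialValue : ∀ {n} → Vec Carrier n → Vec ℕ n → Carrier
  monomialValue [] [] = 1#
  monomialValue (x ∷ xs) (e ∷ es) = x ^ e * monomialValue xs es

  monomialValue-⊕ : ∀ {n} (x : Vec Carrier n) e f →
    monomialValue x (e ⊕ f) ≈ monomialValue x e * monomialValue x f
  monomialValue-⊕ [] [] [] = sym (*-identityˡ 1#)
  monomialValue-⊕ (x ∷ xs) (e ∷ es) (f ∷ fs) =
    trans (*-cong (^-homo-* x e f) (monomialValue-⊕ xs es fs))
          (solve 4 (λ a b c d → (a :* b) :* (c :* d) := (a :* c) :* (b :* d)) refl _ _ _ _)

  eval : Vec Carrier 4 → Poly F → Carrier
  eval x p = ∑[ t ∈ p ] proj₁ t * monomialValue x (proj₂ t)

  eval-++ : ∀ x p q → eval x (p ++ q) ≈ eval x p + eval x q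
  eval-++ x p q = ∑-++ p q _

  eval-*ₚ : ∀ x p q → eval x (_*ₚ_ F p q) ≈ eval x p * eval x q
  eval-*ₚ x p q = begin
    eval x (_*ₚ_ F p q)                                              ≈⟨ ∑-*ₚ p q _ ⟩
    (∑[ s ∈ p ] ∑[ t ∈ q ] (proj₁ s * proj₁ t) * monomialValue x (proj₂ s ⊕ proj₂ t)) ≈⟨ ∑-cong p (λ s → ∑-cong q (λ t → value-·ₜ s t)) ⟩
    (∑[ s ∈ p ] ∑[ t ∈ q ] value s * value t)                        ≈⟨ ∑-cong p (λ s → ∑-*ˡ q (value s) value) ⟩
    (∑[ s ∈ p ] value s * eval x q)                                  ≈⟨ ∑-*ʳ p (eval x q) value ⟩
    eval x p * eval x q                                              ∎
    where
    value : Term → Carrier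
    value (a , e) = a * monomialValue x e
    value-·ₜ : ∀ s t → (proj₁ s * proj₁ t) * monomialValue x (proj₂ s ⊕ proj₂ t) ≈ value s * value t
    value-·ₜ (a , e) (b , f) = trans (*-congˡ (monomialValue-⊕ x e f))
      (solve 4 (λ a b m n → (a :* b) :* (m :* n) := (a :* m) :* (b :* n)) refl a b _ _)

  eval-neg : ∀ x p → eval x (-ₚ p) ≈ - eval x p
  eval-neg x p = begin
    eval x (-ₚ p)                                           ≡⟨ ∑-map _ p _ ⟩
    (∑[ t ∈ p ] - proj₁ t * monomialValue x (proj₂ t))      ≈⟨ ∑-cong p (λ t → sym (-‿distribˡ-* _ _)) ⟩
    (∑[ t ∈ p ] - (proj₁ t * monomialValue x (proj₂ t)))    ≈⟨ ∑-neg p _ ⟩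
    - eval x p                                              ∎

  eval-linPoly : ∀ x l → eval x (linPoly F l) ≈ evalLin F l x
  eval-linPoly (x₀ ∷ x₁ ∷ x₂ ∷ x₃ ∷ []) (a₀ ∷ a₁ ∷ a₂ ∷ a₃ ∷ []) =
    solve 8 (λ a₀ a₁ a₂ a₃ x₀ x₁ x₂ x₃ →
        a₀ :* ((x₀ :* con 1ℤ) :* (con 1ℤ :* (con 1ℤ :* (con 1ℤ :* con 1ℤ))))
     :+ (a₁ :* (con 1ℤ :* ((x₁ :* con 1ℤ) :* (con 1ℤ :* (con 1ℤ :* con 1ℤ))))
     :+ (a₂ :* (con 1ℤ :* (con 1ℤ :* ((x₂ :* con 1ℤ) :* (con 1ℤ :* con 1ℤ))))
     :+ (a₃ :* (con 1ℤ :* (con 1ℤ :* (con 1ℤ :* ((x₃ :* con 1ℤ) :* con 1ℤ)))) :+ con 0ℤ)))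
      := a₀ :* x₀ :+ (a₁ :* x₁ :+ (a₂ :* x₂ :+ (a₃ :* x₃ :+ con 0ℤ)))) refl a₀ a₁ a₂ a₃ x₀ x₁ x₂ x₃

  eval-1ₚ : ∀ x → eval x (1ₚ F) ≈ 1#
  eval-1ₚ (x₀ ∷ x₁ ∷ x₂ ∷ x₃ ∷ []) =
    solve 0 (con 1ℤ :* (con 1ℤ :* (con 1ℤ :* (con 1ℤ :* (con 1ℤ :* con 1ℤ)))) :+ con 0ℤ := con 1ℤ) refl

  dropMonomial : Monomial F → Poly F → Poly F
  dropMonomial e [] = []
  dropMonomial e ((a , f) ∷ p) with ≡-dec ℕ._≟_ f e
  ... | yes _ = dropMonomial e p
  ... | no  _ = (a , f) ∷ dropMonomial e p

  eval-dropMonomial : ∀ x e p → eval x p ≈ coeff F p e * monomialValue x e + eval x (dropMonomial e p)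
  eval-dropMonomial x e [] = solve 1 (λ v → con 0ℤ := con 0ℤ :* v :+ con 0ℤ) refl _
  eval-dropMonomial x e ((a , f) ∷ p) with ≡-dec ℕ._≟_ f e
  ... | yes ≡.refl = trans (+-congˡ (eval-dropMonomial x e p))
          (solve 4 (λ a v c r → a :* v :+ (c :* v :+ r) := (a :+ c) :* v :+ r) refl _ _ _ _)
  ... | no  _ = trans (+-congˡ (eval-dropMonomial x e p))
          (solve 4 (λ a v c r → a :+ (c :* v :+ r) := c :* v :+ (a :+ r)) refl _ _ _ _)

  coeff-dropMonomial-≢ : ∀ e p m → e ≢ m → coeff F (dropMonomial e p) m ≈ coeff F p m
  coeff-dropMonomial-≢ e [] m e≢m = refl
  coeff-dropMonomial-≢ e ((a , f) ∷ p) m e≢m with ≡-dec ℕ._≟_ f e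
  ... | yes ≡.refl = trans (coeff-dropMonomial-≢ e p m e≢m)
          (sym (trans (coeff-∷ (a , f) p m) (trans (+-congʳ (termCoeff-≢ a e≢m)) (+-identityˡ _))))
  ... | no  _ = trans (coeff-∷ (a , f) (dropMonomial e p) m)
          (trans (+-congˡ (coeff-dropMonomial-≢ e p m e≢m)) (sym (coeff-∷ (a , f) p m)))

  coeff-dropMonomial-self : ∀ e p → coeff F (dropMonomial e p) e ≈ 0#
  coeff-dropMonomial-self e [] = refl
  coeff-dropMonomial-self e ((a , f) ∷ p) with ≡-dec ℕ._≟_ f e
  ... | yes _ = coeff-dropMonomial-self e p
  ... | no f≢e = trans (coeff-∷ (a , f) (dropMonomial e p) e)
          (trans (+-cong (termCoeff-≢ a f≢e) (coeff-dropMonomial-self e p)) (+-identityˡ 0#))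

  length-dropMonomial : ∀ e p → length (dropMonomial e p) ≤ length p
  length-dropMonomial e [] = ℕ.z≤n
  length-dropMonomial e ((a , f) ∷ p) with ≡-dec ℕ._≟_ f e
  ... | yes _ = ℕ.m≤n⇒m≤1+n (length-dropMonomial e p)
  ... | no  _ = ℕ.s≤s (length-dropMonomial e p)

  length-dropMonomial-head : ∀ a e p → length (dropMonomial e ((a , e) ∷ p)) ≤ length p
  length-dropMonomial-head a e p with ≡-dec ℕ._≟_ e e
  ... | yes _ = length-dropMonomial e p
  ... | no e≢e = ⊥-elim (e≢e ≡.refl)

  -- Induction on the length: dropping every term with the head's monomial leaves a shorter
  -- polynomial whose coefficients still vanish.
  eval-≃0 : ∀ x p → p ≃ 0ₚ F → eval x p ≈ 0#
  eval-≃0 x p (mk≃ p≈0) = bounded (length p) p ℕ.≤-refl p≈0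
    where
    bounded : ∀ n p → length p ≤ n → (∀ m → coeff F p m ≈ 0#) → eval x p ≈ 0#
    bounded n [] _ _ = refl
    bounded (suc n) ((a , e) ∷ p) (ℕ.s≤s |p|≤n) p≈0 = begin
      eval x ((a , e) ∷ p)                                              ≈⟨ eval-dropMonomial x e ((a , e) ∷ p) ⟩
      coeff F ((a , e) ∷ p) e * monomialValue x e + eval x p′           ≈⟨ +-cong (*-congʳ (p≈0 e)) p′≈0 ⟩
      0# * monomialValue x e + 0#                                       ≈⟨ solve 1 (λ v → con 0ℤ :* v :+ con 0ℤ := con 0ℤ) refl _ ⟩
      0#                                                                ∎
      where
      p′ : Poly F
      p′ = dropMonomial e ((a , e) ∷ p)
      coeff-p′ : ∀ m → coeff F p′ m ≈ 0#
      coeff-p′ m with ≡-dec ℕ._≟_ e m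
      ... | yes ≡.refl = coeff-dropMonomial-self e ((a , e) ∷ p)
      ... | no e≢m = trans (coeff-dropMonomial-≢ e ((a , e) ∷ p) m e≢m) (p≈0 m)
      p′≈0 : eval x p′ ≈ 0#
      p′≈0 = bounded n p′ (ℕ.≤-trans (length-dropMonomial-head a e p) |p|≤n) coeff-p′

  module 𝒫 = CommutativeRing polyRing

  eval-cong : ∀ x {p q} → p ≃ q → eval x p ≈ eval x q
  eval-cong x {p} {q} p≃q = begin
    eval x p                            ≈⟨ solve 2 (λ a b → a := (a :- b) :+ b) refl _ _ ⟩
    (eval x p - eval x q) + eval x q    ≈⟨ +-congʳ (+-congˡ (eval-neg x q)) ⟨
    (eval x p + eval x (-ₚ q)) + eval x q ≈⟨ +-congʳ (eval-++ x p (-ₚ q)) ⟨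
    eval x (p ++ -ₚ q) + eval x q       ≈⟨ +-congʳ (eval-≃0 x _ (𝒫.trans (𝒫.+-congʳ p≃q) (𝒫.-‿inverseʳ q))) ⟩
    0# + eval x q                       ≈⟨ +-identityˡ _ ⟩
    eval x q                            ∎

  Homogeneous : ℕ → Poly F → Set c
  Homogeneous d = All (λ t → degree (proj₂ t) ≡ d)

  homogeneous-*ₚ : ∀ {d d′} p q → Homogeneous d p → Homogeneous d′ q → Homogeneous (d ℕ.+ d′) (_*ₚ_ F p q)
  homogeneous-*ₚ [] q _ _ = []
  homogeneous-*ₚ ((a , e) ∷ p) q (≡.refl ∷ hp) hq =
    All.++⁺ (All.map⁺ (All.map (λ {t} ∣f∣≡d′ → ≡.trans (degree-⊕ e (proj₂ t)) (≡.cong (degree e ℕ.+_) ∣f∣≡d′)) hq)) (homogeneous-*ₚ p q hp hq)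

  homogeneous-linPoly : ∀ l → Homogeneous 1 (linPoly F l)
  homogeneous-linPoly (a₀ ∷ a₁ ∷ a₂ ∷ a₃ ∷ []) = ≡.refl ∷ ≡.refl ∷ ≡.refl ∷ ≡.refl ∷ []

  homogeneous-product : ∀ ls → Homogeneous (length ls) (productₚ F (List.map (linPoly F) ls))
  homogeneous-product [] = ≡.refl ∷ []
  homogeneous-product (l ∷ ls) = homogeneous-*ₚ (linPoly F l) _ (homogeneous-linPoly l) (homogeneous-product ls)

  coeff-homogeneous : ∀ {d} p m → Homogeneous d p → degree m ≢ d → coeff F p m ≈ 0#
  coeff-homogeneous [] m [] _ = refl
  coeff-homogeneous ((a , e) ∷ p) m (≡.refl ∷ hp) ∣m∣≢∣e∣ =
    trans (coeff-∷ (a , e) p m)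
      (trans (+-cong (termCoeff-≢ a {e} {m} λ { ≡.refl → ∣m∣≢∣e∣ ≡.refl }) (coeff-homogeneous p m hp ∣m∣≢∣e∣)) (+-identityˡ 0#))

  OrderAtLeast : ℕ → Poly F → Set ℓ
  OrderAtLeast r p = ∀ m → degree m < r → coeff F p m ≈ 0#

  orderAtLeast-cong : ∀ {r} {p q} → p ≃ q → OrderAtLeast r p → OrderAtLeast r q
  orderAtLeast-cong (mk≃ p≈q) ord-p m <r = trans (sym (p≈q m)) (ord-p m <r)

  orderAtLeast-++ : ∀ {r} p q → OrderAtLeast r p → OrderAtLeast r q → OrderAtLeast r (p ++ q)
  orderAtLeast-++ p q ord-p ord-q m <r =
    trans (coeff-++ p q m) (trans (+-cong (ord-p m <r) (ord-q m <r)) (+-identityˡ 0#))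

  orderAtLeast-*ₚ : ∀ {r} h q → OrderAtLeast r q → OrderAtLeast r (_*ₚ_ F h q)
  orderAtLeast-*ₚ [] q ord-q m <r = refl
  orderAtLeast-*ₚ ((a , e) ∷ h) q ord-q m <r =
    trans (coeff-++ (termTimes (a , e) q) _ m) (trans (+-cong (termTimes-term m <r) (orderAtLeast-*ₚ h q ord-q m <r)) (+-identityˡ 0#))
    where
    termTimes-term : ∀ m → degree m < _ → coeff F (termTimes (a , e) q) m ≈ 0#
    termTimes-term m <r with e ∣? m
    ... | inj₁ (m′ , ≡.refl) = trans (coeff-termTimes-∣ a e q m′) (trans (*-congˡ (ord-q m′ m′<r)) (zeroʳ a))
      where m′<r = ℕ.≤-<-trans (≡.subst (degree m′ ≤_) (≡.sym (degree-⊕ e m′)) (ℕ.m≤n+m _ _)) <r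
    ... | inj₂ e∤m = coeff-termTimes-∤ a e q m e∤m

  homogeneous⇒orderAtLeast : ∀ {r d} p → Homogeneous d p → r ≤ d → OrderAtLeast r p
  homogeneous⇒orderAtLeast p hp r≤d m <r = coeff-homogeneous p m hp λ { ≡.refl → ℕ.<⇒≱ <r r≤d }

  homogeneous∧orderAtLeast⇒≃0 : ∀ {d} p → Homogeneous d p → OrderAtLeast (suc d) p → p ≃ 0ₚ F
  homogeneous∧orderAtLeast⇒≃0 {d} p hp ord-p = mk≃ coefficientwise
    where
    coefficientwise : ∀ m → coeff F p m ≈ 0#
    coefficientwise m with degree m ℕ.≟ d
    ... | yes ∣m∣≡d = ord-p m (ℕ.s≤s (ℕ.≤-reflexive ∣m∣≡d))
    ... | no ∣m∣≢d = coeff-homogeneous p m hp ∣m∣≢d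

  orderAtLeast-ideal : ∀ {r} gs f → All (OrderAtLeast r) gs → InIdealGen F gs f → OrderAtLeast r f
  orderAtLeast-ideal gs f ord-gs (hs , _ , f≈∑) = orderAtLeast-cong {p = sumₚ F (List.zipWith (_*ₚ_ F) hs gs)} {f} (mk≃ λ m → sym (f≈∑ m)) (combination hs gs ord-gs)
    where
    combination : ∀ hs gs → All (OrderAtLeast _) gs → OrderAtLeast _ (sumₚ F (List.zipWith (_*ₚ_ F) hs gs))
    combination [] gs _ m <r = refl
    combination (h ∷ hs) [] _ m <r = refl
    combination (h ∷ hs) (g ∷ gs) (ord-g ∷ ord-gs) =
      orderAtLeast-++ (_*ₚ_ F h g) _ (orderAtLeast-*ₚ h g ord-g) (combination hs gs ord-gs)

module LinearAlgebra {c ℓ} (F : Field c ℓ) where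
  open Field F hiding (zero)
  open CommutativeRingSolver commRing
  open import Relation.Binary.Reasoning.Setoid setoid
  open import Algebra.Properties.Ring ring using (-1*x≈-x)

  *-cancelˡ-≈0 : ∀ {x y} → x ≉ 0# → x * y ≈ 0# → y ≈ 0#
  *-cancelˡ-≈0 {x} {y} x≉0 xy≈0 = begin
    y              ≈⟨ *-identityˡ y ⟨
    1# * y         ≈⟨ *-congʳ x⁻¹x≈1 ⟨
    (x⁻¹ * x) * y  ≈⟨ *-assoc x⁻¹ x y ⟩
    x⁻¹ * (x * y)  ≈⟨ *-congˡ xy≈0 ⟩
    x⁻¹ * 0#       ≈⟨ zeroʳ x⁻¹ ⟩
    0#             ∎
    where
    x⁻¹ : Carrier
    x⁻¹ = proj₁ (inverse x x≉0)
    x⁻¹x≈1 : x⁻¹ * x ≈ 1#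
    x⁻¹x≈1 = trans (*-comm x⁻¹ x) (proj₂ (inverse x x≉0))

  *-≉0 : ∀ {x y} → x ≉ 0# → y ≉ 0# → x * y ≉ 0#
  *-≉0 x≉0 y≉0 = y≉0 ∘ *-cancelˡ-≈0 x≉0

  infixl 6 _⊞_
  infixr 7 _⊡_
  infix 8 _∙_

  _⊞_ : ∀ {n} → Vec Carrier n → Vec Carrier n → Vec Carrier n
  _⊞_ = zipWith _+_

  _⊡_ : ∀ {n} → Carrier → Vec Carrier n → Vec Carrier n
  k ⊡ u = Vec.map (k *_) u

  -- For n = 4 this is evalLin F l x by definition.
  _∙_ : ∀ {n} → Vec Carrier n → Vec Carrier n → Carrier
  l ∙ x = Vec.foldr _ _+_ 0# (zipWith _*_ l x)

  infix 4 _≋_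
  _≋_ : ∀ {n} → Vec Carrier n → Vec Carrier n → Set (c ⊔ ℓ)
  _≋_ = Pointwise _≈_

  0ᵥ : ∀ {n} → Vec Carrier n
  0ᵥ = Vec.replicate _ 0#

  ∙-zeroʳ : ∀ {n} (l : Vec Carrier n) → l ∙ 0ᵥ ≈ 0#
  ∙-zeroʳ [] = refl
  ∙-zeroʳ (a ∷ l) = trans (+-cong (zeroʳ a) (∙-zeroʳ l)) (+-identityˡ 0#)

  ∙-distribʳ-⊞ : ∀ {n} (l x y : Vec Carrier n) → l ∙ (x ⊞ y) ≈ l ∙ x + l ∙ y
  ∙-distribʳ-⊞ [] [] [] = sym (+-identityˡ 0#)
  ∙-distribʳ-⊞ (a ∷ l) (x ∷ xs) (y ∷ ys) = trans (+-congˡ (∙-distribʳ-⊞ l xs ys))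
    (solve 5 (λ a x y u v → a :* (x :+ y) :+ (u :+ v) := (a :* x :+ u) :+ (a :* y :+ v)) refl a x y _ _)

  ∙-distribˡ-⊞ : ∀ {n} (u v x : Vec Carrier n) → (u ⊞ v) ∙ x ≈ u ∙ x + v ∙ x
  ∙-distribˡ-⊞ [] [] [] = sym (+-identityˡ 0#)
  ∙-distribˡ-⊞ (a ∷ u) (b ∷ v) (x ∷ xs) = trans (+-congˡ (∙-distribˡ-⊞ u v xs))
    (solve 5 (λ a b x s t → (a :+ b) :* x :+ (s :+ t) := (a :* x :+ s) :+ (b :* x :+ t)) refl a b x _ _)

  ∙-⊡ʳ : ∀ {n} (l : Vec Carrier n) k x → l ∙ (k ⊡ x) ≈ k * l ∙ x
  ∙-⊡ʳ [] k [] = sym (zeroʳ k)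
  ∙-⊡ʳ (a ∷ l) k (x ∷ xs) = trans (+-congˡ (∙-⊡ʳ l k xs))
    (solve 4 (λ a k x s → a :* (k :* x) :+ k :* s := k :* (a :* x :+ s)) refl a k x _)

  ∙-⊡ˡ : ∀ {n} k (l x : Vec Carrier n) → (k ⊡ l) ∙ x ≈ k * l ∙ x
  ∙-⊡ˡ k [] [] = sym (zeroʳ k)
  ∙-⊡ˡ k (a ∷ l) (x ∷ xs) = trans (+-congˡ (∙-⊡ˡ k l xs))
    (solve 4 (λ a k x s → (k :* a) :* x :+ k :* s := k :* (a :* x :+ s)) refl a k x _)

  ∙-translate : ∀ {n} (l y : Vec Carrier n) t z → l ∙ (y ⊞ t ⊡ z) ≈ l ∙ y + t * l ∙ z
  ∙-translate l y t z = trans (∙-distribʳ-⊞ l y (t ⊡ z)) (+-congˡ (∙-⊡ʳ l t z))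

  ∙-comm : ∀ {n} (u v : Vec Carrier n) → u ∙ v ≈ v ∙ u
  ∙-comm [] [] = refl
  ∙-comm (a ∷ u) (b ∷ v) = +-cong (*-comm a b) (∙-comm u v)

  ∙-minus : ∀ {n} (l y w : Vec Carrier n) → l ∙ (y ⊞ - 1# ⊡ w) ≈ l ∙ y - l ∙ w
  ∙-minus l y w = trans (∙-translate l y (- 1#) w) (+-congˡ (-1*x≈-x _))

  ∙-head : ∀ {n} a (l : Vec Carrier n) → (a ∷ l) ∙ (1# ∷ 0ᵥ) ≈ a
  ∙-head a l = trans (+-cong (*-identityʳ a) (∙-zeroʳ l)) (+-identityʳ a)

  ∙-tail : ∀ {n} a (l y : Vec Carrier n) → (a ∷ l) ∙ (0# ∷ y) ≈ l ∙ y
  ∙-tail a l y = trans (+-congʳ (zeroʳ a)) (+-identityˡ _)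

  ≋-from-∙ : ∀ {n} (u v : Vec Carrier n) → (∀ y → u ∙ y ≈ v ∙ y) → u ≋ v
  ≋-from-∙ [] [] _ = []
  ≋-from-∙ (a ∷ u) (b ∷ v) u≈v =
    trans (sym (∙-head a u)) (trans (u≈v (1# ∷ 0ᵥ)) (∙-head b v))
    ∷ ≋-from-∙ u v (λ y → trans (sym (∙-tail a u y)) (trans (u≈v (0# ∷ y)) (∙-tail b v y)))

  ≋0-from-∙ : ∀ {n} (l : Vec Carrier n) → (∀ x → ¬ ¬ (l ∙ x ≈ 0#)) → ¬ ¬ (l ≋ 0ᵥ)
  ≋0-from-∙ [] _ = return []
  ≋0-from-∙ (a ∷ l) l≈0 = do
    a≈0 ← l≈0 (1# ∷ 0ᵥ)
    l≋0 ← ≋0-from-∙ l (λ y ¬l∙y≈0 → l≈0 (0# ∷ y) (¬l∙y≈0 ∘ trans (sym (∙-tail a l y))))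
    return (trans (sym (∙-head a l)) a≈0 ∷ l≋0)

  ∙-congˡ : ∀ {n} {u v : Vec Carrier n} x → u ≋ v → u ∙ x ≈ v ∙ x
  ∙-congˡ [] [] = refl
  ∙-congˡ (x ∷ xs) (a≈b ∷ u≋v) = +-cong (*-congʳ a≈b) (∙-congˡ xs u≋v)

  ∙-congʳ : ∀ {n} (l : Vec Carrier n) {x y} → x ≋ y → l ∙ x ≈ l ∙ y
  ∙-congʳ [] [] = refl
  ∙-congʳ (a ∷ l) (x≈y ∷ xs≋ys) = +-cong (*-congˡ x≈y) (∙-congʳ l xs≋ys)

  ∙-≋0 : ∀ {n} (l : Vec Carrier n) {x} → x ≋ 0ᵥ → l ∙ x ≈ 0#
  ∙-≋0 l x≋0 = trans (∙-congʳ l x≋0) (∙-zeroʳ l)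

  combination₄ : ∀ {n} (μ₁ μ₂ μ₃ μ₄ : Carrier) (v₁ v₂ v₃ v₄ : Vec Carrier n) → Vec Carrier n
  combination₄ μ₁ μ₂ μ₃ μ₄ v₁ v₂ v₃ v₄ = μ₁ ⊡ v₁ ⊞ μ₂ ⊡ v₂ ⊞ μ₃ ⊡ v₃ ⊞ μ₄ ⊡ v₄

  combination₄-∙ : ∀ {n} μ₁ μ₂ μ₃ μ₄ (v₁ v₂ v₃ v₄ y : Vec Carrier n) →
    combination₄ μ₁ μ₂ μ₃ μ₄ v₁ v₂ v₃ v₄ ∙ y ≈ μ₁ * v₁ ∙ y + μ₂ * v₂ ∙ y + μ₃ * v₃ ∙ y + μ₄ * v₄ ∙ y
  combination₄-∙ μ₁ μ₂ μ₃ μ₄ v₁ v₂ v₃ v₄ y =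
    trans (∙-distribˡ-⊞ (μ₁ ⊡ v₁ ⊞ μ₂ ⊡ v₂ ⊞ μ₃ ⊡ v₃) _ y) (+-cong
      (trans (∙-distribˡ-⊞ (μ₁ ⊡ v₁ ⊞ μ₂ ⊡ v₂) _ y) (+-cong
        (trans (∙-distribˡ-⊞ (μ₁ ⊡ v₁) _ y) (+-cong (∙-⊡ˡ μ₁ v₁ y) (∙-⊡ˡ μ₂ v₂ y)))
        (∙-⊡ˡ μ₃ v₃ y)))
      (∙-⊡ˡ μ₄ v₄ y))

  module Pivot {n} (h : Carrier) (w : Vec Carrier n) (h≉0 : h ≉ 0#) where

    h⁻¹ : Carrier
    h⁻¹ = proj₁ (inverse h h≉0)

    reduce : Vec Carrier (suc n) → Vec Carrier n
    reduce (ρ ∷ u) = u ⊞ (- (ρ * h⁻¹)) ⊡ w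

    lift : Vec Carrier n → Vec Carrier (suc n)
    lift y = - (h⁻¹ * w ∙ y) ∷ y

    lift-∙ : ∀ y r → r ∙ lift y ≈ reduce r ∙ y
    lift-∙ y (ρ ∷ u) = begin
      ρ * - (h⁻¹ * w ∙ y) + u ∙ y       ≈⟨ solve 4 (λ ρ h⁻¹ W U → ρ :* :- (h⁻¹ :* W) :+ U := U :+ :- (ρ :* h⁻¹) :* W) refl ρ h⁻¹ _ _ ⟩
      u ∙ y + - (ρ * h⁻¹) * w ∙ y       ≈⟨ +-congˡ (∙-⊡ˡ (- (ρ * h⁻¹)) w y) ⟨
      u ∙ y + (- (ρ * h⁻¹) ⊡ w) ∙ y     ≈⟨ ∙-distribˡ-⊞ u _ y ⟨
      reduce (ρ ∷ u) ∙ y                ∎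

    reduce-pivot : ∀ y → reduce (h ∷ w) ∙ y ≈ 0#
    reduce-pivot y = begin
      reduce (h ∷ w) ∙ y                ≈⟨ ∙-distribˡ-⊞ w _ y ⟩
      w ∙ y + (- (h * h⁻¹) ⊡ w) ∙ y     ≈⟨ +-congˡ (∙-⊡ˡ (- (h * h⁻¹)) w y) ⟩
      w ∙ y + - (h * h⁻¹) * w ∙ y       ≈⟨ +-congˡ (*-congʳ (-‿cong (proj₂ (inverse h h≉0)))) ⟩
      w ∙ y + - 1# * w ∙ y              ≈⟨ solve 1 (λ W → W :+ :- con 1ℤ :* W := con 0ℤ) refl _ ⟩
      0#                                ∎

  -- Gaussian elimination on the first column: either every row starts with 0, and the first unit
  -- vector is a solution, or some row h ∷ w with h ≉ 0 eliminates x₀ from the others.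
  nontrivialSolution : ∀ n (rows : List (Vec Carrier n)) → length rows < n →
    ¬ ¬ (Σ (Vec Carrier n) λ x → ¬ (x ≋ 0ᵥ) × All (λ r → r ∙ x ≈ 0#) rows)
  nontrivialSolution (suc n) rows |rows|≤n = ¬¬-excluded-middle >>= λ where
      (yes pivot) → eliminate (find pivot)
      (no noPivot) → do
        e₀-solves ← ¬¬-All (All.map (λ {r} ¬r₀≉0 ¬r∙e₀≈0 → ¬r₀≉0 (¬r∙e₀≈0 ∘ head≈0 r)) (All.¬Any⇒All¬ rows noPivot))
        return (1# ∷ 0ᵥ , (λ { (1≈0 ∷ _) → 1≉0 1≈0 }) , e₀-solves)
    where
    head≈0 : ∀ r → Vec.head r ≈ 0# → r ∙ (1# ∷ 0ᵥ) ≈ 0#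
    head≈0 (h ∷ w) h≈0 = trans (+-cong (trans (*-identityʳ h) h≈0) (∙-zeroʳ w)) (+-identityˡ 0#)
    eliminate : (Σ (Vec Carrier (suc n)) λ r → r ∈ rows × Vec.head r ≉ 0#) →
                ¬ ¬ (Σ (Vec Carrier (suc n)) λ x → ¬ (x ≋ 0ᵥ) × All (λ r → r ∙ x ≈ 0#) rows)
    eliminate (h ∷ w , h∷w∈rows , h≉0) with ∈-∃++ h∷w∈rows
    ... | ys , zs , ≡.refl = do
          (y , y≉0 , y-solves) ← nontrivialSolution n (List.map reduce (ys ++ zs)) |reduced|<n
          let ys-solve , zs-solve = All.++⁻ ys (All.map⁻ y-solves)
          return (lift y , (λ { (_ ∷ y≋0) → y≉0 y≋0 })
                 , All.++⁺ (All.map (λ {r} → solves y r) ys-solve)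
                           (trans (lift-∙ y (h ∷ w)) (reduce-pivot y) ∷ All.map (λ {r} → solves y r) zs-solve))
      where
      open Pivot h w h≉0
      |reduced|<n : length (List.map reduce (ys ++ zs)) < n
      |reduced|<n = ≡.subst (_< n) (≡.sym (List.length-map reduce (ys ++ zs)))
        (≡.subst (_≤ n) (List.length-++-sucʳ ys (h ∷ w) zs) (ℕ.≤-pred |rows|≤n))
      solves : ∀ y r → reduce r ∙ y ≈ 0# → r ∙ lift y ≈ 0#
      solves y r reduced≈0 = trans (lift-∙ y r) reduced≈0

  Point : Set c
  Point = Vec Carrier 4

  -- Disjoint F L M is Independent₄ (form₁ L) (form₂ L) (form₁ M) (form₂ M) by definition.
  Independent₄ : (f₁ f₂ f₃ f₄ : LinearForm F) → Set (c ⊔ ℓ)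
  Independent₄ f₁ f₂ f₃ f₄ =
    ∀ x → f₁ ∙ x ≈ 0# → f₂ ∙ x ≈ 0# → f₃ ∙ x ≈ 0# → f₄ ∙ x ≈ 0# → IsZeroVec F x

  isZeroVec⇒≋0 : ∀ {x} → IsZeroVec F x → x ≋ 0ᵥ
  isZeroVec⇒≋0 {_ ∷ _ ∷ _ ∷ _ ∷ []} (x₀≈0 , x₁≈0 , x₂≈0 , x₃≈0) = x₀≈0 ∷ x₁≈0 ∷ x₂≈0 ∷ x₃≈0 ∷ []

  ≋0⇒isZeroVec : ∀ {x} → x ≋ 0ᵥ → IsZeroVec F x
  ≋0⇒isZeroVec (x₀≈0 ∷ x₁≈0 ∷ x₂≈0 ∷ x₃≈0 ∷ []) = x₀≈0 , x₁≈0 , x₂≈0 , x₃≈0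

  module Independent₄Forms (f₁ f₂ f₃ f₄ : LinearForm F) (indep : Independent₄ f₁ f₂ f₃ f₄) where

    -- A nontrivial solution (s , x) of the homogeneous system f ∙ x = b s has s ≉ 0 by
    -- independence; then x / s solves the inhomogeneous one.
    solvable : ∀ b₁ b₂ b₃ b₄ →
      ¬ ¬ (Σ Point λ x → f₁ ∙ x ≈ b₁ × f₂ ∙ x ≈ b₂ × f₃ ∙ x ≈ b₃ × f₄ ∙ x ≈ b₄)
    solvable b₁ b₂ b₃ b₄ = do
      (s ∷ x , sx≉0 , e₁ ∷ e₂ ∷ e₃ ∷ e₄ ∷ []) ← nontrivialSolution 5 rows ℕ.≤-refl
      s≈0? ← ¬¬-excluded-middle
      case s≈0? of λ where
        (yes s≈0) → contradiction (sx≈0 s≈0 e₁ e₂ e₃ e₄) sx≉0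
        (no s≉0) → let s⁻¹ = proj₁ (inverse s s≉0) ; ss⁻¹≈1 = proj₂ (inverse s s≉0) in
          return (s⁻¹ ⊡ x , divide f₁ x s⁻¹ ss⁻¹≈1 e₁ , divide f₂ x s⁻¹ ss⁻¹≈1 e₂
                            , divide f₃ x s⁻¹ ss⁻¹≈1 e₃ , divide f₄ x s⁻¹ ss⁻¹≈1 e₄)
      where
      rows : List (Vec Carrier 5)
      rows = (- b₁ ∷ f₁) ∷ (- b₂ ∷ f₂) ∷ (- b₃ ∷ f₃) ∷ (- b₄ ∷ f₄) ∷ []
      equation : ∀ {b s} f x → (- b ∷ f) ∙ (s ∷ x) ≈ 0# → f ∙ x ≈ b * s
      equation {b} {s} f x e = begin
        f ∙ x                        ≈⟨ solve 3 (λ b s X → X := (:- b :* s :+ X) :+ b :* s) refl b s _ ⟩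
        (- b * s + f ∙ x) + b * s    ≈⟨ +-congʳ e ⟩
        0# + b * s                   ≈⟨ +-identityˡ _ ⟩
        b * s                        ∎
      sx≈0 : ∀ {s x} → s ≈ 0# → (- b₁ ∷ f₁) ∙ (s ∷ x) ≈ 0# → (- b₂ ∷ f₂) ∙ (s ∷ x) ≈ 0# →
             (- b₃ ∷ f₃) ∙ (s ∷ x) ≈ 0# → (- b₄ ∷ f₄) ∙ (s ∷ x) ≈ 0# → (s ∷ x) ≋ 0ᵥ
      sx≈0 {s} {x} s≈0 e₁ e₂ e₃ e₄ =
        s≈0 ∷ isZeroVec⇒≋0 (indep x (vanish f₁ e₁) (vanish f₂ e₂) (vanish f₃ e₃) (vanish f₄ e₄))
        where
        vanish : ∀ {b} f → (- b ∷ f) ∙ (s ∷ x) ≈ 0# → f ∙ x ≈ 0#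
        vanish {b} f e = trans (equation f x e) (trans (*-congˡ s≈0) (zeroʳ b))
      divide : ∀ {b s} f x s⁻¹ → s * s⁻¹ ≈ 1# → (- b ∷ f) ∙ (s ∷ x) ≈ 0# → f ∙ (s⁻¹ ⊡ x) ≈ b
      divide {b} {s} f x s⁻¹ ss⁻¹≈1 e = begin
        f ∙ (s⁻¹ ⊡ x)      ≈⟨ ∙-⊡ʳ f s⁻¹ x ⟩
        s⁻¹ * f ∙ x        ≈⟨ *-congˡ (equation f x e) ⟩
        s⁻¹ * (b * s)      ≈⟨ solve 3 (λ s⁻¹ b s → s⁻¹ :* (b :* s) := b :* (s :* s⁻¹)) refl s⁻¹ b s ⟩
        b * (s * s⁻¹)      ≈⟨ *-congˡ ss⁻¹≈1 ⟩
        b * 1#             ≈⟨ *-identityʳ b ⟩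
        b                  ∎

    sameCoordinates⇒∙≈ : ∀ y w →
      f₁ ∙ y ≈ f₁ ∙ w → f₂ ∙ y ≈ f₂ ∙ w → f₃ ∙ y ≈ f₃ ∙ w → f₄ ∙ y ≈ f₄ ∙ w → ∀ g → g ∙ y ≈ g ∙ w
    sameCoordinates⇒∙≈ y w e₁ e₂ e₃ e₄ g = begin
      g ∙ y                       ≈⟨ solve 2 (λ Y W → Y := (Y :- W) :+ W) refl _ _ ⟩
      (g ∙ y - g ∙ w) + g ∙ w     ≈⟨ +-congʳ (∙-minus g y w) ⟨
      g ∙ (y ⊞ - 1# ⊡ w) + g ∙ w  ≈⟨ +-congʳ (∙-≋0 g (isZeroVec⇒≋0 (indep _ (diff f₁ e₁) (diff f₂ e₂) (diff f₃ e₃) (diff f₄ e₄)))) ⟩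
      0# + g ∙ w                  ≈⟨ +-identityˡ _ ⟩
      g ∙ w                       ∎
      where
      diff : ∀ f → f ∙ y ≈ f ∙ w → f ∙ (y ⊞ - 1# ⊡ w) ≈ 0#
      diff f e = trans (∙-minus f y w) (trans (+-congʳ e) (-‿inverseʳ _))

    module DualBasis (x₁ x₂ x₃ x₄ : Point) where

      ∑coords : Point → Point
      ∑coords y = combination₄ (f₁ ∙ y) (f₂ ∙ y) (f₃ ∙ y) (f₄ ∙ y) x₁ x₂ x₃ x₄

      ∙-∑coords : ∀ f y → f ∙ ∑coords y ≈ f₁ ∙ y * f ∙ x₁ + f₂ ∙ y * f ∙ x₂ + f₃ ∙ y * f ∙ x₃ + f₄ ∙ y * f ∙ x₄
      ∙-∑coords f y = trans (∙-comm f _) (trans (combination₄-∙ _ _ _ _ x₁ x₂ x₃ x₄ f)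
        (+-cong (+-cong (+-cong (*-congˡ (∙-comm x₁ f)) (*-congˡ (∙-comm x₂ f))) (*-congˡ (∙-comm x₃ f))) (*-congˡ (∙-comm x₄ f))))

      coordinate : ∀ y f {d₁ d₂ d₃ d₄} → f ∙ x₁ ≈ d₁ → f ∙ x₂ ≈ d₂ → f ∙ x₃ ≈ d₃ → f ∙ x₄ ≈ d₄ →
        f₁ ∙ y * d₁ + f₂ ∙ y * d₂ + f₃ ∙ y * d₃ + f₄ ∙ y * d₄ ≈ f ∙ y → f ∙ y ≈ f ∙ ∑coords y
      coordinate y f e₁ e₂ e₃ e₄ δ = sym (trans (∙-∑coords f y)
        (trans (+-cong (+-cong (+-cong (*-congˡ e₁) (*-congˡ e₂)) (*-congˡ e₃)) (*-congˡ e₄)) δ))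

      expand : ∀ g y → f₁ ∙ y ≈ f₁ ∙ ∑coords y → f₂ ∙ y ≈ f₂ ∙ ∑coords y → f₃ ∙ y ≈ f₃ ∙ ∑coords y →
        f₄ ∙ y ≈ f₄ ∙ ∑coords y → g ∙ y ≈ combination₄ (g ∙ x₁) (g ∙ x₂) (g ∙ x₃) (g ∙ x₄) f₁ f₂ f₃ f₄ ∙ y
      expand g y e₁ e₂ e₃ e₄ = begin
        g ∙ y                   ≈⟨ sameCoordinates⇒∙≈ y (∑coords y) e₁ e₂ e₃ e₄ g ⟩
        g ∙ ∑coords y           ≈⟨ ∙-∑coords g y ⟩
        f₁ ∙ y * g ∙ x₁ + f₂ ∙ y * g ∙ x₂ + f₃ ∙ y * g ∙ x₃ + f₄ ∙ y * g ∙ x₄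
          ≈⟨ +-cong (+-cong (+-cong (*-comm _ _) (*-comm _ _)) (*-comm _ _)) (*-comm _ _) ⟩
        g ∙ x₁ * f₁ ∙ y + g ∙ x₂ * f₂ ∙ y + g ∙ x₃ * f₃ ∙ y + g ∙ x₄ * f₄ ∙ y
          ≈⟨ combination₄-∙ _ _ _ _ f₁ f₂ f₃ f₄ y ⟨
        combination₄ (g ∙ x₁) (g ∙ x₂) (g ∙ x₃) (g ∙ x₄) f₁ f₂ f₃ f₄ ∙ y ∎

    -- With a dual basis x₁ … x₄ (fᵢ ∙ xⱼ = δᵢⱼ), every point y agrees in all coordinates with
    -- ∑ⱼ (fⱼ ∙ y) xⱼ, so g ∙ y = ∑ⱼ (g ∙ xⱼ) (fⱼ ∙ y).
    spanning : ∀ g →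
      ¬ ¬ (Σ Carrier λ μ₁ → Σ Carrier λ μ₂ → Σ Carrier λ μ₃ → Σ Carrier λ μ₄ →
           g ≋ combination₄ μ₁ μ₂ μ₃ μ₄ f₁ f₂ f₃ f₄)
    spanning g = do
      (x₁ , f₁x₁ , f₂x₁ , f₃x₁ , f₄x₁) ← solvable 1# 0# 0# 0#
      (x₂ , f₁x₂ , f₂x₂ , f₃x₂ , f₄x₂) ← solvable 0# 1# 0# 0#
      (x₃ , f₁x₃ , f₂x₃ , f₃x₃ , f₄x₃) ← solvable 0# 0# 1# 0#
      (x₄ , f₁x₄ , f₂x₄ , f₃x₄ , f₄x₄) ← solvable 0# 0# 0# 1#
      let open DualBasis x₁ x₂ x₃ x₄
      return (g ∙ x₁ , g ∙ x₂ , g ∙ x₃ , g ∙ x₄ , ≋-from-∙ g _ λ y →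
        expand g y (coordinate y f₁ f₁x₁ f₁x₂ f₁x₃ f₁x₄ (δ₁ _ _ _ _)) (coordinate y f₂ f₂x₁ f₂x₂ f₂x₃ f₂x₄ (δ₂ _ _ _ _))
                   (coordinate y f₃ f₃x₁ f₃x₂ f₃x₃ f₃x₄ (δ₃ _ _ _ _)) (coordinate y f₄ f₄x₁ f₄x₂ f₄x₃ f₄x₄ (δ₄ _ _ _ _)))
      where
      δ₁ : ∀ a b c d → a * 1# + b * 0# + c * 0# + d * 0# ≈ a
      δ₁ = solve 4 (λ a b c d → a :* con 1ℤ :+ b :* con 0ℤ :+ c :* con 0ℤ :+ d :* con 0ℤ := a) refl
      δ₂ : ∀ a b c d → a * 0# + b * 1# + c * 0# + d * 0# ≈ b
      δ₂ = solve 4 (λ a b c d → a :* con 0ℤ :+ b :* con 1ℤ :+ c :* con 0ℤ :+ d :* con 0ℤ := b) refl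
      δ₃ : ∀ a b c d → a * 0# + b * 0# + c * 1# + d * 0# ≈ c
      δ₃ = solve 4 (λ a b c d → a :* con 0ℤ :+ b :* con 0ℤ :+ c :* con 1ℤ :+ d :* con 0ℤ := c) refl
      δ₄ : ∀ a b c d → a * 0# + b * 0# + c * 0# + d * 1# ≈ d
      δ₄ = solve 4 (λ a b c d → a :* con 0ℤ :+ b :* con 0ℤ :+ c :* con 0ℤ :+ d :* con 1ℤ := d) refl

  OnLine : Line F → Point → Set ℓ
  OnLine L x = form₁ L ∙ x ≈ 0# × form₂ L ∙ x ≈ 0#

  -- Vanishing is taken in double-negated form: equality in k need not be decidable, and this is
  -- what the negation of "l is nonzero at some point of L" yields.
  VanishesOn : Line F → LinearForm F → Set (c ⊔ ℓ)
  VanishesOn L l = ∀ x → OnLine L x → ¬ ¬ (l ∙ x ≈ 0#)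

  -- Every x splits as (x - z) + z with z ∈ M and x - z ∈ L.
  vanishesOnDisjointLines⇒≋0 : ∀ {L M} l → Disjoint F L M → VanishesOn L l → VanishesOn M l → ¬ ¬ (l ≋ 0ᵥ)
  vanishesOnDisjointLines⇒≋0 {L} {M} l disj l|L≈0 l|M≈0 = ≋0-from-∙ l λ x → do
    (z , ux≈uz , vx≈vz , u′z≈0 , v′z≈0) ← solvable (form₁ L ∙ x) (form₂ L ∙ x) 0# 0#
    lz≈0 ← l|M≈0 z (u′z≈0 , v′z≈0)
    l[x-z]≈0 ← l|L≈0 (x ⊞ - 1# ⊡ z) (difference (form₁ L) ux≈uz , difference (form₂ L) vx≈vz)
    return (begin
      l ∙ x                            ≈⟨ solve 2 (λ X Z → X := (X :- Z) :+ Z) refl _ _ ⟩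
      (l ∙ x - l ∙ z) + l ∙ z          ≈⟨ +-cong (trans (sym (∙-minus l x z)) l[x-z]≈0) lz≈0 ⟩
      0# + 0#                          ≈⟨ +-identityˡ 0# ⟩
      0#                               ∎)
    where
    open Independent₄Forms (form₁ L) (form₂ L) (form₁ M) (form₂ M) disj using (solvable)
    difference : ∀ {x z} f → f ∙ z ≈ f ∙ x → f ∙ (x ⊞ - 1# ⊡ z) ≈ 0#
    difference {x} {z} f fz≈fx = trans (∙-minus f x z) (trans (+-congˡ (-‿cong fz≈fx)) (-‿inverseʳ _))

  line-nonzeroPoint : ∀ L → ¬ ¬ (Σ Point λ x → OnLine L x × ¬ (x ≋ 0ᵥ))
  line-nonzeroPoint L = do
    (x , x≉0 , ux≈0 ∷ vx≈0 ∷ []) ← nontrivialSolution 4 (form₁ L ∷ form₂ L ∷ []) (ℕ.s≤s (ℕ.s≤s (ℕ.s≤s ℕ.z≤n)))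
    return (x , (ux≈0 , vx≈0) , x≉0)

  form₁≉0 : ∀ L → ¬ (form₁ L ≋ 0ᵥ)
  form₁≉0 L u≋0 = 1≉0 (proj₁ (independent L 1# 0# (≋0⇒isZeroVec (1⊡u⊞0⊡v≋0 (form₂ L) u≋0))))
    where
    1⊡u⊞0⊡v≋0 : ∀ {n} {u : Vec Carrier n} v → u ≋ 0ᵥ → 1# ⊡ u ⊞ 0# ⊡ v ≋ 0ᵥ
    1⊡u⊞0⊡v≋0 [] [] = []
    1⊡u⊞0⊡v≋0 (b ∷ v) (a≈0 ∷ u≋0) =
      trans (+-cong (trans (*-identityˡ _) a≈0) (zeroˡ b)) (+-identityˡ 0#) ∷ 1⊡u⊞0⊡v≋0 v u≋0

  AffineAlong : ∀ {d} → (Point → Set d) → (Point → Carrier) → Set (c ⊔ ℓ ⊔ d)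
  AffineAlong D φ = ∀ y z → D z → Σ Carrier λ σ → ∀ t → φ (y ⊞ t ⊡ z) ≈ φ y + t * σ

  constant-affine : ∀ {d} {D : Point → Set d} k → AffineAlong D (λ _ → k)
  constant-affine k y z _ = 0# , λ t → sym (trans (+-congˡ (zeroʳ t)) (+-identityʳ k))

  module InfiniteField (inf : Infinite F) where

    private
      ι : ℕ → Carrier
      ι = proj₁ inf

      ι-injective : ∀ m n → ι m ≈ ι n → m ≡ n
      ι-injective = proj₂ inf

    -- (α , β) stands for the affine function t ↦ α + t β.
    Affine : Set c
    Affine = Carrier × Carrier

    _at_ : Affine → Carrier → Carrier
    (α , β) at t = α + t * β

    NonZero : Affine → Set ℓ
    NonZero (α , β) = ¬ (α ≈ 0# × β ≈ 0#)

    nonZero⇒atMostOneRoot : ∀ {p t t′} → NonZero p → p at t ≈ 0# → p at t′ ≈ 0# → ¬ ¬ (t ≈ t′)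
    nonZero⇒atMostOneRoot {α , β} {t} {t′} p≉0 pt≈0 pt′≈0 = do
      β≈0? ← ¬¬-excluded-middle
      case β≈0? of λ where
        (yes β≈0) → contradiction (α≈0 β≈0 , β≈0) p≉0
        (no β≉0) → return (begin
          t                  ≈⟨ solve 2 (λ t t′ → t := (t :- t′) :+ t′) refl t t′ ⟩
          (t - t′) + t′      ≈⟨ +-congʳ (*-cancelˡ-≈0 β≉0 β[t-t′]≈0) ⟩
          0# + t′            ≈⟨ +-identityˡ t′ ⟩
          t′                 ∎)
      where
      α≈0 : β ≈ 0# → α ≈ 0#
      α≈0 β≈0 = trans (solve 3 (λ α t β → α := (α :+ t :* β) :- t :* β) refl α t β)
                      (trans (+-cong pt≈0 (-‿cong (trans (*-congˡ β≈0) (zeroʳ t)))) (-‿inverseʳ 0#))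
      β[t-t′]≈0 : β * (t - t′) ≈ 0#
      β[t-t′]≈0 = trans (solve 4 (λ α β t t′ → β :* (t :- t′) := (α :+ t :* β) :- (α :+ t′ :* β)) refl α β t t′)
                        (trans (+-cong pt≈0 (-‿cong pt′≈0)) (-‿inverseʳ 0#))

    -- Each affine function has at most one root, so all but finitely many ι m avoid them all.
    eventuallyNonRoot : ∀ ps → All NonZero ps → ¬ ¬ (Σ ℕ λ N → ∀ m → N < m → All (λ p → p at ι m ≉ 0#) ps)
    eventuallyNonRoot [] [] = return (0 , λ _ _ → [])
    eventuallyNonRoot (p ∷ ps) (p≉0 ∷ ps≉0) = do
      (N , N<⇒ps) ← eventuallyNonRoot ps ps≉0
      root? ← ¬¬-excluded-middle {A = Σ ℕ λ m → p at ι m ≈ 0#}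
      case root? of λ where
        (yes (m₀ , pm₀≈0)) → return (N ℕ.+ m₀ , λ m N+m₀<m →
          (λ pm≈0 → nonZero⇒atMostOneRoot p≉0 pm≈0 pm₀≈0 λ ιm≈ιm₀ →
             ℕ.<-irrefl (≡.sym (ι-injective m m₀ ιm≈ιm₀)) (ℕ.≤-<-trans (ℕ.m≤n+m m₀ N) N+m₀<m))
          ∷ N<⇒ps m (ℕ.≤-<-trans (ℕ.m≤m+n N m₀) N+m₀<m))
        (no noRoot) → return (N , λ m N<m → (λ pm≈0 → noRoot (m , pm≈0)) ∷ N<⇒ps m N<m)

    commonNonRoot : ∀ ps → All NonZero ps → ¬ ¬ (Σ Carrier λ t → All (λ p → p at t ≉ 0#) ps)
    commonNonRoot ps ps≉0 = do
      (N , N<⇒ps) ← eventuallyNonRoot ps ps≉0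
      return (ι (suc N) , N<⇒ps (suc N) ℕ.≤-refl)

    -- Move the point along a direction z ∈ D on which the next form l is nonzero: every function
    -- that is already nonzero stays a nonzero affine function of t, and so does l.
    genericPoint : ∀ {s d} {S : Point → Set s} {D : Point → Set d} →
      (∀ {y z} t → S y → D z → S (y ⊞ t ⊡ z)) →
      ∀ {φ} → AffineAlong D φ →
      ∀ ls → All (λ l → ¬ ¬ (Σ Point λ z → D z × l ∙ z ≉ 0#)) ls →
      ∀ {y₀} → S y₀ → φ y₀ ≉ 0# →
      ¬ ¬ (Σ Point λ y → S y × φ y ≉ 0# × All (λ l → l ∙ y ≉ 0#) ls)
    genericPoint closed φ-affine [] [] Sy₀ φy₀≉0 = return (_ , Sy₀ , φy₀≉0 , [])
    genericPoint closed {φ} φ-affine (l ∷ ls) (l-nonzero ∷ ls-nonzero) Sy₀ φy₀≉0 = do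
      (y , Sy , φy≉0 , lsy≉0) ← genericPoint closed φ-affine ls ls-nonzero Sy₀ φy₀≉0
      (z , Dz , lz≉0) ← l-nonzero
      let σ , φ-along = φ-affine y z Dz
          along : LinearForm F → Affine
          along l′ = (l′ ∙ y , l′ ∙ z)
      (t , φ≉0 ∷ l≉0 ∷ ls≉0) ← commonNonRoot ((φ y , σ) ∷ along l ∷ List.map along ls)
        ((λ (φy≈0 , _) → φy≉0 φy≈0) ∷ (λ (_ , lz≈0) → lz≉0 lz≈0)
          ∷ All.map⁺ (All.map (λ ly≉0 (ly≈0 , _) → ly≉0 ly≈0) lsy≉0))
      return (y ⊞ t ⊡ z , closed t Sy Dz , φ≉0 ∘ trans (sym (φ-along t))
             , (l≉0 ∘ trans (sym (∙-translate l y t z)))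
             ∷ All.map (λ {l′} l′≉0 → l′≉0 ∘ trans (sym (∙-translate l′ y t z))) (All.map⁻ ls≉0))

module LineIdeals {c ℓ} (F : Field c ℓ) where
  open Field F hiding (zero)
  open CommutativeRingSolver commRing
  open Polynomials F
  open LinearAlgebra F
  open import Relation.Binary.Reasoning.Setoid setoid
  open CommutativeRingSolver polyRing using () renaming
    (solve to solveᴾ; _:=_ to _:=ᴾ_; _:+_ to _:+ᴾ_; _:*_ to _:*ᴾ_; :-_ to :-ᴾ_; con to conᴾ)
  open 𝒫 using () renaming (_+_ to _+ᴾ_; _*_ to _*ᴾ_; -_ to -ᴾ_; 0# to 0ᴾ; 1# to 1ᴾ)

  productOf : List (LinearForm F) → Poly F
  productOf ls = productₚ F (List.map (linPoly F) ls)

  productAt : List (LinearForm F) → Point → Carrier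
  productAt ls x = List.foldr (λ l v → l ∙ x * v) 1# ls

  eval-productOf : ∀ x ls → eval x (productOf ls) ≈ productAt ls x
  eval-productOf x [] = eval-1ₚ x
  eval-productOf x (l ∷ ls) = trans (eval-*ₚ x (linPoly F l) (productOf ls)) (*-cong (eval-linPoly x l) (eval-productOf x ls))

  productAt-≉0 : ∀ x ls → All (λ l → l ∙ x ≉ 0#) ls → productAt ls x ≉ 0#
  productAt-≉0 x [] [] = 1≉0
  productAt-≉0 x (l ∷ ls) (lx≉0 ∷ lsx≉0) = *-≉0 lx≉0 (productAt-≉0 x ls lsx≉0)

  -- δ m records which variable, if any, the monomial m is; thus coeff (linPoly l) m = l ∙ δ m.
  δ : Monomial F → Vec Carrier 4
  δ m = termCoeff (1# , 1 ∷ 0 ∷ 0 ∷ 0 ∷ []) m ∷ termCoeff (1# , 0 ∷ 1 ∷ 0 ∷ 0 ∷ []) m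
      ∷ termCoeff (1# , 0 ∷ 0 ∷ 1 ∷ 0 ∷ []) m ∷ termCoeff (1# , 0 ∷ 0 ∷ 0 ∷ 1 ∷ []) m ∷ []

  coeff-linPoly : ∀ l m → coeff F (linPoly F l) m ≈ l ∙ δ m
  coeff-linPoly l@(a₀ ∷ a₁ ∷ a₂ ∷ a₃ ∷ []) m = trans (coeff≈∑ (linPoly F l) m)
    (+-cong (scale a₀ (1 ∷ 0 ∷ 0 ∷ 0 ∷ [])) (+-cong (scale a₁ (0 ∷ 1 ∷ 0 ∷ 0 ∷ []))
      (+-cong (scale a₂ (0 ∷ 0 ∷ 1 ∷ 0 ∷ [])) (+-congʳ (scale a₃ (0 ∷ 0 ∷ 0 ∷ 1 ∷ []))))))
    where
    scale : ∀ a e → termCoeff (a , e) m ≈ a * termCoeff (1# , e) m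
    scale a e = trans (termCoeff-cong {e = e} m (sym (*-identityʳ a)) ≡.refl) (termCoeff-*ˡ a 1# e m)

  linPoly-cong : ∀ {u v} → u ≋ v → linPoly F u ≃ linPoly F v
  linPoly-cong {u} {v} u≋v = mk≃ λ m →
    trans (coeff-linPoly u m) (trans (∙-congˡ (δ m) u≋v) (sym (coeff-linPoly v m)))

  linPoly-≋0 : ∀ {l} → l ≋ 0ᵥ → linPoly F l ≃ 0ᴾ
  linPoly-≋0 {l} l≋0 = mk≃ λ m →
    trans (coeff-linPoly l m) (trans (∙-congˡ (δ m) l≋0) (trans (∙-comm 0ᵥ (δ m)) (∙-zeroʳ (δ m))))

  linPoly-⊞ : ∀ u v → linPoly F (u ⊞ v) ≃ linPoly F u +ᴾ linPoly F v
  linPoly-⊞ u v = mk≃ λ m → begin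
    coeff F (linPoly F (u ⊞ v)) m                   ≈⟨ coeff-linPoly (u ⊞ v) m ⟩
    (u ⊞ v) ∙ δ m                                   ≈⟨ ∙-distribˡ-⊞ u v (δ m) ⟩
    u ∙ δ m + v ∙ δ m                               ≈⟨ +-cong (coeff-linPoly u m) (coeff-linPoly v m) ⟨
    coeff F (linPoly F u) m + coeff F (linPoly F v) m ≈⟨ coeff-++ (linPoly F u) (linPoly F v) m ⟨
    coeff F (linPoly F u +ᴾ linPoly F v) m          ∎

  constₚ : Carrier → Poly F
  constₚ k = (k , Vec.replicate 4 0) ∷ []

  coeff-constₚ-*ₚ : ∀ k p m → coeff F (constₚ k *ᴾ p) m ≈ k * coeff F p m
  coeff-constₚ-*ₚ k p m = begin
    coeff F (termTimes (k , Vec.replicate 4 0) p ++ []) m        ≡⟨ ≡.cong (λ m′ → coeff F (termTimes (k , Vec.replicate 4 0) p ++ []) m′) (⊕-identityˡ m) ⟨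
    coeff F (termTimes (k , Vec.replicate 4 0) p ++ []) (Vec.replicate 4 0 ⊕ m) ≈⟨ coeff-++ (termTimes _ p) [] _ ⟩
    coeff F (termTimes (k , Vec.replicate 4 0) p) (Vec.replicate 4 0 ⊕ m) + 0# ≈⟨ +-identityʳ _ ⟩
    coeff F (termTimes (k , Vec.replicate 4 0) p) (Vec.replicate 4 0 ⊕ m) ≈⟨ coeff-termTimes-∣ k _ p m ⟩
    k * coeff F p m                                               ∎

  linPoly-⊡ : ∀ k u → linPoly F (k ⊡ u) ≃ constₚ k *ᴾ linPoly F u
  linPoly-⊡ k u = mk≃ λ m → begin
    coeff F (linPoly F (k ⊡ u)) m          ≈⟨ coeff-linPoly (k ⊡ u) m ⟩
    (k ⊡ u) ∙ δ m                          ≈⟨ ∙-⊡ˡ k u (δ m) ⟩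
    k * u ∙ δ m                            ≈⟨ *-congˡ (coeff-linPoly u m) ⟨
    k * coeff F (linPoly F u) m            ≈⟨ coeff-constₚ-*ₚ k (linPoly F u) m ⟨
    coeff F (constₚ k *ᴾ linPoly F u) m    ∎

  form₁ᴾ form₂ᴾ : Line F → Poly F
  form₁ᴾ L = linPoly F (form₁ L)
  form₂ᴾ L = linPoly F (form₂ L)

  inLineIdeal⁺ : ∀ L {f} h₁ h₂ → f ≃ h₁ *ᴾ form₁ᴾ L +ᴾ (h₂ *ᴾ form₂ᴾ L +ᴾ 0ᴾ) → InLineIdeal F L f
  inLineIdeal⁺ L h₁ h₂ (mk≃ f≈) = (h₁ ∷ h₂ ∷ []) , ≡.refl , f≈

  inLineIdeal⁻ : ∀ L {f} → InLineIdeal F L f →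
    Σ (Poly F) λ h₁ → Σ (Poly F) λ h₂ → f ≃ h₁ *ᴾ form₁ᴾ L +ᴾ (h₂ *ᴾ form₂ᴾ L +ᴾ 0ᴾ)
  inLineIdeal⁻ L ((h₁ ∷ h₂ ∷ []) , _ , f≈) = h₁ , h₂ , mk≃ f≈

  inLineIdeal⇒vanishes : ∀ L {f} → InLineIdeal F L f → ∀ x → OnLine L x → eval x f ≈ 0#
  inLineIdeal⇒vanishes L {f} f∈I x (ux≈0 , vx≈0) with inLineIdeal⁻ L {f} f∈I
  ... | h₁ , h₂ , f≃ = begin
    eval x f                                                              ≈⟨ eval-cong x f≃ ⟩
    eval x (h₁ *ᴾ form₁ᴾ L +ᴾ (h₂ *ᴾ form₂ᴾ L +ᴾ 0ᴾ))                      ≈⟨ eval-++ x (h₁ *ᴾ form₁ᴾ L) _ ⟩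
    eval x (h₁ *ᴾ form₁ᴾ L) + eval x (h₂ *ᴾ form₂ᴾ L +ᴾ 0ᴾ)               ≈⟨ +-congˡ (eval-++ x (h₂ *ᴾ form₂ᴾ L) []) ⟩
    eval x (h₁ *ᴾ form₁ᴾ L) + (eval x (h₂ *ᴾ form₂ᴾ L) + 0#)              ≈⟨ +-cong (eval-*ₚ x h₁ _) (+-congʳ (eval-*ₚ x h₂ _)) ⟩
    eval x h₁ * eval x (form₁ᴾ L) + (eval x h₂ * eval x (form₂ᴾ L) + 0#)  ≈⟨ +-cong (*-congˡ (trans (eval-linPoly x (form₁ L)) ux≈0))
                                                                                     (+-congʳ (*-congˡ (trans (eval-linPoly x (form₂ L)) vx≈0))) ⟩
    eval x h₁ * 0# + (eval x h₂ * 0# + 0#)                                ≈⟨ solve 2 (λ a b → a :* con 0ℤ :+ (b :* con 0ℤ :+ con 0ℤ) := con 0ℤ) refl _ _ ⟩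
    0#                                                                    ∎

  inLineIdeal-*ʳ : ∀ L {f} → InLineIdeal F L f → ∀ g → InLineIdeal F L (f *ᴾ g)
  inLineIdeal-*ʳ L {f} f∈I g with inLineIdeal⁻ L {f} f∈I
  ... | h₁ , h₂ , f≃ = inLineIdeal⁺ L (h₁ *ᴾ g) (h₂ *ᴾ g) (𝒫.trans (𝒫.*-congʳ f≃)
    (solveᴾ 5 (λ h₁ h₂ u v g → (h₁ :*ᴾ u :+ᴾ (h₂ :*ᴾ v :+ᴾ conᴾ 0ℤ)) :*ᴾ g
                               :=ᴾ h₁ :*ᴾ g :*ᴾ u :+ᴾ (h₂ :*ᴾ g :*ᴾ v :+ᴾ conᴾ 0ℤ)) 𝒫.refl h₁ h₂ (form₁ᴾ L) (form₂ᴾ L) g))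

  inIdealGen-∷ : ∀ g {gs f} → InIdealGen F gs f → InIdealGen F (g ∷ gs) f
  inIdealGen-∷ g (hs , |hs|≡|gs| , f≈) = 0ᴾ ∷ hs , ≡.cong suc |hs|≡|gs| , f≈

  generators∈ideal : ∀ gs → All (InIdealGen F gs) gs
  generators∈ideal [] = []
  generators∈ideal (g ∷ gs) =
    (1ᴾ ∷ zeros , ≡.cong suc (List.length-replicate (length gs)) , coeffwise g≃)
    ∷ All.map (λ {f} → inIdealGen-∷ g {gs} {f}) (generators∈ideal gs)
    where
    zeros : List (Poly F)
    zeros = List.replicate (length gs) 0ᴾ
    ∑zeros≡[] : ∀ gs → sumₚ F (List.zipWith (_*ₚ_ F) (List.replicate (length gs) 0ᴾ) gs) ≡ []
    ∑zeros≡[] [] = ≡.refl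
    ∑zeros≡[] (_ ∷ gs) = ∑zeros≡[] gs
    g≃ : g ≃ 1ᴾ *ᴾ g +ᴾ sumₚ F (List.zipWith (_*ₚ_ F) zeros gs)
    g≃ = 𝒫.sym (𝒫.trans (𝒫.+-congˡ (𝒫.reflexive (∑zeros≡[] gs))) (𝒫.trans (𝒫.+-identityʳ _) (𝒫.*-identityˡ g)))

  productOf-factor : ∀ {l} ls → l ∈ ls → Σ (Poly F) λ R → productOf ls ≃ R *ᴾ linPoly F l
  productOf-factor (l ∷ ls) (here ≡.refl) = productOf ls , 𝒫.*-comm (linPoly F l) (productOf ls)
  productOf-factor (l′ ∷ ls) (there l∈ls) =
    let R , ∏ls≃ = productOf-factor ls l∈ls
    in linPoly F l′ *ᴾ R , 𝒫.trans (𝒫.*-congˡ {linPoly F l′} ∏ls≃) (𝒫.sym (𝒫.*-assoc (linPoly F l′) R _))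

  productOf-≃0 : ∀ ls (k : Fin (length ls)) → List.lookup ls k ≋ 0ᵥ → productOf ls ≃ 0ᴾ
  productOf-≃0 (l ∷ ls) Fin.zero l≋0 = 𝒫.trans (𝒫.*-congʳ {productOf ls} (linPoly-≋0 l≋0)) (𝒫.zeroˡ (productOf ls))
  productOf-≃0 (l ∷ ls) (Fin.suc k) lₖ≋0 = 𝒫.trans (𝒫.*-congˡ {linPoly F l} (productOf-≃0 ls k lₖ≋0)) (𝒫.zeroʳ (linPoly F l))

  onLine-translate : ∀ L {y z} t → OnLine L y → OnLine L z → OnLine L (y ⊞ t ⊡ z)
  onLine-translate L {y} {z} t (uy≈0 , vy≈0) (uz≈0 , vz≈0) = along (form₁ L) uy≈0 uz≈0 , along (form₂ L) vy≈0 vz≈0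
    where
    along : ∀ f → f ∙ y ≈ 0# → f ∙ z ≈ 0# → f ∙ (y ⊞ t ⊡ z) ≈ 0#
    along f fy≈0 fz≈0 = trans (∙-translate f y t z) (trans (+-cong fy≈0 (trans (*-congˡ fz≈0) (zeroʳ t))) (+-identityˡ 0#))

  onLine-0 : ∀ L → OnLine L 0ᵥ
  onLine-0 L = ∙-zeroʳ (form₁ L) , ∙-zeroʳ (form₂ L)

  ¬vanishes⇒nonzeroSomewhere : ∀ L l → ¬ VanishesOn L l → ¬ ¬ (Σ Point λ z → OnLine L z × l ∙ z ≉ 0#)
  ¬vanishes⇒nonzeroSomewhere L l ¬l|L≈0 ¬nonzero = ¬l|L≈0 λ x x∈L lx≉0 → ¬nonzero (x , x∈L , lx≉0)

  linPoly-combination₂ : ∀ s u t v → linPoly F (s ⊡ u ⊞ t ⊡ v) ≃ constₚ s *ᴾ linPoly F u +ᴾ constₚ t *ᴾ linPoly F v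
  linPoly-combination₂ s u t v = 𝒫.trans (linPoly-⊞ (s ⊡ u) (t ⊡ v)) (𝒫.+-cong (linPoly-⊡ s u) (linPoly-⊡ t v))

  linPoly-combination₄ : ∀ μ₁ μ₂ μ₃ μ₄ v₁ v₂ v₃ v₄ → linPoly F (combination₄ μ₁ μ₂ μ₃ μ₄ v₁ v₂ v₃ v₄) ≃
    constₚ μ₁ *ᴾ linPoly F v₁ +ᴾ constₚ μ₂ *ᴾ linPoly F v₂ +ᴾ constₚ μ₃ *ᴾ linPoly F v₃ +ᴾ constₚ μ₄ *ᴾ linPoly F v₄
  linPoly-combination₄ μ₁ μ₂ μ₃ μ₄ v₁ v₂ v₃ v₄ =
    𝒫.trans (linPoly-⊞ (μ₁ ⊡ v₁ ⊞ μ₂ ⊡ v₂ ⊞ μ₃ ⊡ v₃) (μ₄ ⊡ v₄)) (𝒫.+-cong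
      (𝒫.trans (linPoly-⊞ (μ₁ ⊡ v₁ ⊞ μ₂ ⊡ v₂) (μ₃ ⊡ v₃)) (𝒫.+-cong (linPoly-combination₂ μ₁ v₁ μ₂ v₂) (linPoly-⊡ μ₃ v₃)))
      (linPoly-⊡ μ₄ v₄))

  -- Writing u₁ = c₁u₂ + c₂v₂ + c₃u₀ + c₄v₀ and v₁ = d₁u₂ + d₂v₂ + d₃u₀ + d₄v₀,
  -- the forms ℓ₁ = d₃u₁ - c₃v₁ and ℓ₂ = d₄u₁ - c₄v₁ lie in (u₁, v₁) and are ≡ (c₄d₃ - c₃d₄) v₀ and
  -- (c₃d₄ - c₄d₃) u₀ modulo (u₂, v₂); hence Q = u₀ℓ₁ + v₀ℓ₂ lies in (u₀, v₀), (u₁, v₁) and (u₂, v₂).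
  module Quadric (L₀ L₁ L₂ : Line F) (c₁ c₂ c₃ c₄ d₁ d₂ d₃ d₄ : Carrier)
    (c≋ : form₁ L₁ ≋ combination₄ c₁ c₂ c₃ c₄ (form₁ L₂) (form₂ L₂) (form₁ L₀) (form₂ L₀))
    (d≋ : form₂ L₁ ≋ combination₄ d₁ d₂ d₃ d₄ (form₁ L₂) (form₂ L₂) (form₁ L₀) (form₂ L₀)) where

    private
      u₀ v₀ u₁ v₁ u₂ v₂ : LinearForm F
      u₀ = form₁ L₀
      v₀ = form₂ L₀
      u₁ = form₁ L₁
      v₁ = form₂ L₁
      u₂ = form₁ L₂
      v₂ = form₂ L₂

      U₀ V₀ U₁ V₁ U₂ V₂ : Poly F
      U₀ = linPoly F u₀
      V₀ = linPoly F v₀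
      U₁ = linPoly F u₁
      V₁ = linPoly F v₁
      U₂ = linPoly F u₂
      V₂ = linPoly F v₂

    ℓ₁ ℓ₂ : LinearForm F
    ℓ₁ = d₃ ⊡ u₁ ⊞ (- c₃) ⊡ v₁
    ℓ₂ = d₄ ⊡ u₁ ⊞ (- c₄) ⊡ v₁

    Q : Poly F
    Q = U₀ *ᴾ linPoly F ℓ₁ +ᴾ V₀ *ᴾ linPoly F ℓ₂

    Q∈I₀ : InLineIdeal F L₀ Q
    Q∈I₀ = inLineIdeal⁺ L₀ (linPoly F ℓ₁) (linPoly F ℓ₂)
      (solveᴾ 4 (λ A B L₁ L₂ → A :*ᴾ L₁ :+ᴾ B :*ᴾ L₂ :=ᴾ L₁ :*ᴾ A :+ᴾ (L₂ :*ᴾ B :+ᴾ conᴾ 0ℤ))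
        𝒫.refl U₀ V₀ (linPoly F ℓ₁) (linPoly F ℓ₂))

    Q≃ : Q ≃ U₀ *ᴾ (constₚ d₃ *ᴾ U₁ +ᴾ constₚ (- c₃) *ᴾ V₁)
           +ᴾ V₀ *ᴾ (constₚ d₄ *ᴾ U₁ +ᴾ constₚ (- c₄) *ᴾ V₁)
    Q≃ = 𝒫.+-cong (𝒫.*-congˡ {U₀} (linPoly-combination₂ d₃ u₁ (- c₃) v₁))
                  (𝒫.*-congˡ {V₀} (linPoly-combination₂ d₄ u₁ (- c₄) v₁))

    Q∈I₁ : InLineIdeal F L₁ Q
    Q∈I₁ = inLineIdeal⁺ L₁ (constₚ d₃ *ᴾ U₀ +ᴾ constₚ d₄ *ᴾ V₀)
                           (constₚ (- c₃) *ᴾ U₀ +ᴾ constₚ (- c₄) *ᴾ V₀)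
      (𝒫.trans Q≃ (solveᴾ 8 (λ A B C D X₃ Y₃ X₄ Y₄ →
         A :*ᴾ (X₃ :*ᴾ C :+ᴾ Y₃ :*ᴾ D) :+ᴾ B :*ᴾ (X₄ :*ᴾ C :+ᴾ Y₄ :*ᴾ D)
         :=ᴾ (X₃ :*ᴾ A :+ᴾ X₄ :*ᴾ B) :*ᴾ C :+ᴾ ((Y₃ :*ᴾ A :+ᴾ Y₄ :*ᴾ B) :*ᴾ D :+ᴾ conᴾ 0ℤ))
         𝒫.refl U₀ V₀ U₁ V₁
                (constₚ d₃) (constₚ (- c₃)) (constₚ d₄) (constₚ (- c₄))))

    Q∈I₂ : InLineIdeal F L₂ Q
    Q∈I₂ = inLineIdeal⁺ L₂
      (U₀ *ᴾ (K d₃ *ᴾ K c₁ +ᴾ -ᴾ K c₃ *ᴾ K d₁) +ᴾ V₀ *ᴾ (K d₄ *ᴾ K c₁ +ᴾ -ᴾ K c₄ *ᴾ K d₁))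
      (U₀ *ᴾ (K d₃ *ᴾ K c₂ +ᴾ -ᴾ K c₃ *ᴾ K d₂) +ᴾ V₀ *ᴾ (K d₄ *ᴾ K c₂ +ᴾ -ᴾ K c₄ *ᴾ K d₂))
      (𝒫.trans Q≃ (𝒫.trans (𝒫.+-cong
        (𝒫.*-congˡ {U₀} (𝒫.+-cong (𝒫.*-congˡ {K d₃} C≃) (𝒫.*-congˡ {K (- c₃)} D≃)))
        (𝒫.*-congˡ {V₀} (𝒫.+-cong (𝒫.*-congˡ {K d₄} C≃) (𝒫.*-congˡ {K (- c₄)} D≃))))
        (solveᴾ 12 (λ A B P Q′ C₁ C₂ C₃ C₄ D₁ D₂ D₃ D₄ →
           let C = C₁ :*ᴾ P :+ᴾ C₂ :*ᴾ Q′ :+ᴾ C₃ :*ᴾ A :+ᴾ C₄ :*ᴾ B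
               D = D₁ :*ᴾ P :+ᴾ D₂ :*ᴾ Q′ :+ᴾ D₃ :*ᴾ A :+ᴾ D₄ :*ᴾ B
           in A :*ᴾ (D₃ :*ᴾ C :+ᴾ :-ᴾ C₃ :*ᴾ D) :+ᴾ B :*ᴾ (D₄ :*ᴾ C :+ᴾ :-ᴾ C₄ :*ᴾ D)
              :=ᴾ (A :*ᴾ (D₃ :*ᴾ C₁ :+ᴾ :-ᴾ C₃ :*ᴾ D₁) :+ᴾ B :*ᴾ (D₄ :*ᴾ C₁ :+ᴾ :-ᴾ C₄ :*ᴾ D₁)) :*ᴾ P
                :+ᴾ ((A :*ᴾ (D₃ :*ᴾ C₂ :+ᴾ :-ᴾ C₃ :*ᴾ D₂) :+ᴾ B :*ᴾ (D₄ :*ᴾ C₂ :+ᴾ :-ᴾ C₄ :*ᴾ D₂)) :*ᴾ Q′ :+ᴾ conᴾ 0ℤ))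
           𝒫.refl U₀ V₀ U₂ V₂ (K c₁) (K c₂) (K c₃) (K c₄) (K d₁) (K d₂) (K d₃) (K d₄))))
      where
      K : Carrier → Poly F
      K = constₚ
      C≃ : U₁ ≃ K c₁ *ᴾ U₂ +ᴾ K c₂ *ᴾ V₂ +ᴾ K c₃ *ᴾ U₀ +ᴾ K c₄ *ᴾ V₀
      C≃ = 𝒫.trans (linPoly-cong c≋) (linPoly-combination₄ c₁ c₂ c₃ c₄ u₂ v₂ u₀ v₀)
      D≃ : V₁ ≃ K d₁ *ᴾ U₂ +ᴾ K d₂ *ᴾ V₂ +ᴾ K d₃ *ᴾ U₀ +ᴾ K d₄ *ᴾ V₀
      D≃ = 𝒫.trans (linPoly-cong d≋) (linPoly-combination₄ d₁ d₂ d₃ d₄ u₂ v₂ u₀ v₀)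

    Q-homogeneous : Homogeneous 2 Q
    Q-homogeneous = All.++⁺ (homogeneous-*ₚ U₀ _ (homogeneous-linPoly u₀) (homogeneous-linPoly ℓ₁))
                            (homogeneous-*ₚ V₀ _ (homogeneous-linPoly v₀) (homogeneous-linPoly ℓ₂))

    value : Point → Carrier
    value y = u₀ ∙ y * ℓ₁ ∙ y + v₀ ∙ y * ℓ₂ ∙ y

    eval-Q : ∀ y → eval y Q ≈ value y
    eval-Q y = trans (eval-++ y (U₀ *ᴾ linPoly F ℓ₁) _) (+-cong
      (trans (eval-*ₚ y U₀ _) (*-cong (eval-linPoly y u₀) (eval-linPoly y ℓ₁)))
      (trans (eval-*ₚ y V₀ _) (*-cong (eval-linPoly y v₀) (eval-linPoly y ℓ₂))))

    value-affine : AffineAlong (OnLine L₀) value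
    value-affine y z (u₀z≈0 , v₀z≈0) = u₀ ∙ y * ℓ₁ ∙ z + v₀ ∙ y * ℓ₂ ∙ z , λ t → begin
      value (y ⊞ t ⊡ z)
        ≈⟨ +-cong (*-cong (∙-translate u₀ y t z) (∙-translate ℓ₁ y t z)) (*-cong (∙-translate v₀ y t z) (∙-translate ℓ₂ y t z)) ⟩
      (u₀ ∙ y + t * u₀ ∙ z) * (ℓ₁ ∙ y + t * ℓ₁ ∙ z) + (v₀ ∙ y + t * v₀ ∙ z) * (ℓ₂ ∙ y + t * ℓ₂ ∙ z)
        ≈⟨ +-cong (*-congʳ (+-congˡ (*-congˡ u₀z≈0))) (*-congʳ (+-congˡ (*-congˡ v₀z≈0))) ⟩
      (u₀ ∙ y + t * 0#) * (ℓ₁ ∙ y + t * ℓ₁ ∙ z) + (v₀ ∙ y + t * 0#) * (ℓ₂ ∙ y + t * ℓ₂ ∙ z)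
        ≈⟨ solve 7 (λ U₀ V₀ L₁ L₁′ L₂ L₂′ t →
             (U₀ :+ t :* con 0ℤ) :* (L₁ :+ t :* L₁′) :+ (V₀ :+ t :* con 0ℤ) :* (L₂ :+ t :* L₂′)
             := (U₀ :* L₁ :+ V₀ :* L₂) :+ t :* (U₀ :* L₁′ :+ V₀ :* L₂′)) refl _ _ _ _ _ _ t ⟩
      value y + t * (u₀ ∙ y * ℓ₁ ∙ z + v₀ ∙ y * ℓ₂ ∙ z) ∎

    coordinates⇒value : ∀ {y α β γ δ} → u₀ ∙ y ≈ α → v₀ ∙ y ≈ β → u₁ ∙ y ≈ γ → v₁ ∙ y ≈ δ →
      value y ≈ α * (d₃ * γ + - c₃ * δ) + β * (d₄ * γ + - c₄ * δ)
    coordinates⇒value {y} u₀y v₀y u₁y v₁y = +-cong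
      (*-cong u₀y (trans (∙-distribˡ-⊞ (d₃ ⊡ u₁) _ y) (+-cong (trans (∙-⊡ˡ d₃ u₁ y) (*-congˡ u₁y)) (trans (∙-⊡ˡ (- c₃) v₁ y) (*-congˡ v₁y)))))
      (*-cong v₀y (trans (∙-distribˡ-⊞ (d₄ ⊡ u₁) _ y) (+-cong (trans (∙-⊡ˡ d₄ u₁ y) (*-congˡ u₁y)) (trans (∙-⊡ˡ (- c₄) v₁ y) (*-congˡ v₁y)))))

    vanishesOnL₂ : ∀ {x} w {μ₁ μ₂ μ₃ μ₄} → w ≋ combination₄ μ₁ μ₂ μ₃ μ₄ u₂ v₂ u₀ v₀ →
                   u₂ ∙ x ≈ 0# → v₂ ∙ x ≈ 0# → μ₃ ≈ 0# → μ₄ ≈ 0# → w ∙ x ≈ 0#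
    vanishesOnL₂ {x} w {μ₁} {μ₂} {μ₃} {μ₄} w≋ u₂x≈0 v₂x≈0 μ₃≈0 μ₄≈0 = begin
      w ∙ x                                                      ≈⟨ ∙-congˡ x w≋ ⟩
      combination₄ μ₁ μ₂ μ₃ μ₄ u₂ v₂ u₀ v₀ ∙ x                   ≈⟨ combination₄-∙ μ₁ μ₂ μ₃ μ₄ u₂ v₂ u₀ v₀ x ⟩
      μ₁ * u₂ ∙ x + μ₂ * v₂ ∙ x + μ₃ * u₀ ∙ x + μ₄ * v₀ ∙ x     ≈⟨ +-cong (+-cong (+-cong (*-congˡ u₂x≈0) (*-congˡ v₂x≈0)) (*-congʳ μ₃≈0)) (*-congʳ μ₄≈0) ⟩
      μ₁ * 0# + μ₂ * 0# + 0# * u₀ ∙ x + 0# * v₀ ∙ x             ≈⟨ solve 4 (λ μ₁ μ₂ U V → μ₁ :* con 0ℤ :+ μ₂ :* con 0ℤ :+ con 0ℤ :* U :+ con 0ℤ :* V := con 0ℤ) refl μ₁ μ₂ _ _ ⟩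
      0#                                                         ∎

    -- If Q vanished everywhere, evaluating it at points with prescribed (u₀, v₀, u₁, v₁) would give
    -- c₃ = c₄ = d₃ = d₄ = 0, so u₁ and v₁ would vanish on L₂.
    value-nonzero : Disjoint F L₀ L₁ → Disjoint F L₁ L₂ → ¬ ¬ (Σ Point λ y → value y ≉ 0#)
    value-nonzero disjoint₀₁ disjoint₁₂ noPoint = ¬¬⊥⇒⊥ do
      d₃≈0 ← E≈0 1# 0# 1# 0# λ E≈0 → trans (sym E-u₀u₁) E≈0
      c₃≈0 ← E≈0 1# 0# 0# 1# λ E≈0 → -≈0 (trans (sym E-u₀v₁) E≈0)
      d₄≈0 ← E≈0 0# 1# 1# 0# λ E≈0 → trans (sym E-v₀u₁) E≈0
      c₄≈0 ← E≈0 0# 1# 0# 1# λ E≈0 → -≈0 (trans (sym E-v₀v₁) E≈0)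
      (x , (u₂x≈0 , v₂x≈0) , x≉0) ← line-nonzeroPoint L₂
      return (x≉0 (isZeroVec⇒≋0 (disjoint₁₂ x (vanishesOnL₂ u₁ c≋ u₂x≈0 v₂x≈0 c₃≈0 c₄≈0)
                                              (vanishesOnL₂ v₁ d≋ u₂x≈0 v₂x≈0 d₃≈0 d₄≈0) u₂x≈0 v₂x≈0)))
      where
      open Independent₄Forms u₀ v₀ u₁ v₁ disjoint₀₁ using (solvable)
      open import Algebra.Properties.Ring ring using (-0#≈0#)
      open import Algebra.Properties.Group +-group using (⁻¹-injective)
      -≈0 : ∀ {κ} → - κ ≈ 0# → κ ≈ 0#
      -≈0 -κ≈0 = ⁻¹-injective (trans -κ≈0 (sym -0#≈0#))
      E : Carrier → Carrier → Carrier → Carrier → Carrier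
      E α β γ δ = α * (d₃ * γ + - c₃ * δ) + β * (d₄ * γ + - c₄ * δ)
      E′ : ∀ {n} (α β γ δ c₃ c₄ d₃ d₄ : Polynomial n) → Polynomial n
      E′ α β γ δ c₃ c₄ d₃ d₄ = α :* (d₃ :* γ :+ :- c₃ :* δ) :+ β :* (d₄ :* γ :+ :- c₄ :* δ)
      E-u₀u₁ : E 1# 0# 1# 0# ≈ d₃
      E-u₀u₁ = solve 4 (λ c₃ c₄ d₃ d₄ → E′ (con 1ℤ) (con 0ℤ) (con 1ℤ) (con 0ℤ) c₃ c₄ d₃ d₄ := d₃) refl c₃ c₄ d₃ d₄
      E-u₀v₁ : E 1# 0# 0# 1# ≈ - c₃
      E-u₀v₁ = solve 4 (λ c₃ c₄ d₃ d₄ → E′ (con 1ℤ) (con 0ℤ) (con 0ℤ) (con 1ℤ) c₃ c₄ d₃ d₄ := :- c₃) refl c₃ c₄ d₃ d₄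
      E-v₀u₁ : E 0# 1# 1# 0# ≈ d₄
      E-v₀u₁ = solve 4 (λ c₃ c₄ d₃ d₄ → E′ (con 0ℤ) (con 1ℤ) (con 1ℤ) (con 0ℤ) c₃ c₄ d₃ d₄ := d₄) refl c₃ c₄ d₃ d₄
      E-v₀v₁ : E 0# 1# 0# 1# ≈ - c₄
      E-v₀v₁ = solve 4 (λ c₃ c₄ d₃ d₄ → E′ (con 0ℤ) (con 1ℤ) (con 0ℤ) (con 1ℤ) c₃ c₄ d₃ d₄ := :- c₄) refl c₃ c₄ d₃ d₄
      E≈0 : ∀ α β γ δ {κ} → (E α β γ δ ≈ 0# → κ ≈ 0#) → ¬ ¬ (κ ≈ 0#)
      E≈0 α β γ δ simplify = do
        (y , u₀y , v₀y , u₁y , v₁y) ← solvable α β γ δ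
        value≈0 ← λ value≉0 → noPoint (y , value≉0)
        return (simplify (trans (sym (coordinates⇒value u₀y v₀y u₁y v₁y)) value≈0))

  module _ (inf : Infinite F) where
    open InfiniteField inf

    -- A line is irreducible: if no factor vanished on L, a generic point of L would make
    -- every factor nonzero.
    productVanishing⇒factorVanishes : ∀ L ls → (∀ x → OnLine L x → productAt ls x ≈ 0#) → ¬ ¬ Any (VanishesOn L) ls
    productVanishing⇒factorVanishes L ls ∏|L≈0 = ¬¬-excluded-middle >>= λ where
      (yes factor) → return factor
      (no noFactor) → do
        (y , y∈L , _ , ls[y]≉0) ← genericPoint (onLine-translate L) {λ _ → 1#} (constant-affine 1#) ls
          (All.map (λ {l} → ¬vanishes⇒nonzeroSomewhere L l) (All.¬Any⇒All¬ ls noFactor)) (onLine-0 L) 1≉0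
        contradiction (∏|L≈0 y y∈L) (productAt-≉0 y ls ls[y]≉0)

    -- With fewer than r factors, two of the r lines would share a vanishing factor, which is then 0.
    productInI⇒orderAtLeast : ∀ {r} (A : Fin r → Line F) → (∀ i j → i ≢ j → Disjoint F (A i) (A j)) →
      ∀ {g} → IsProductOfLinearForms F g → I_ F A g → ¬ ¬ OrderAtLeast r g
    productInI⇒orderAtLeast {r} A disjoint {g} (ls , g≈∏) g∈I = do
      factors ← ¬¬-Π-Fin r λ i → productVanishing⇒factorVanishes (A i) ls (∏|A≈0 i)
      case length ls ℕ.<? r of λ where
        (no |ls|≮r) → return (orderAtLeast-cong ∏≃g (homogeneous⇒orderAtLeast (productOf ls) (homogeneous-product ls) (ℕ.≮⇒≥ |ls|≮r)))
        (yes |ls|<r) → do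
          let i , j , i<j , index≡ = Fin.pigeonhole |ls|<r (λ i → Any.index (factors i))
          lᵢ≋0 ← vanishesOnDisjointLines⇒≋0 {A i} {A j} _ (disjoint i j (Fin.<⇒≢ i<j)) (Any.lookup-index (factors i))
                   (≡.subst (λ k → VanishesOn (A j) (List.lookup ls k)) (≡.sym index≡) (Any.lookup-index (factors j)))
          return λ m _ → trans (g≈∏ m) (coeffwise (productOf-≃0 ls (Any.index (factors i)) lᵢ≋0) m)
      where
      ∏≃g : productOf ls ≃ g
      ∏≃g = mk≃ λ m → sym (g≈∏ m)
      ∏|A≈0 : ∀ i x → OnLine (A i) x → productAt ls x ≈ 0#
      ∏|A≈0 i x x∈Aᵢ = trans (sym (eval-productOf x ls)) (trans (eval-cong x ∏≃g) (inLineIdeal⇒vanishes (A i) {g} (g∈I i) x x∈Aᵢ))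

    module Witness (r′ : ℕ) (A : Fin (3 ℕ.+ r′) → Line F)
                   (disjoint : ∀ i j → i ≢ j → Disjoint F (A i) (A j)) where

      private
        L₀ L₁ L₂ : Line F
        L₀ = A Fin.zero
        L₁ = A (Fin.suc Fin.zero)
        L₂ = A (Fin.suc (Fin.suc Fin.zero))

        Lₖ : Fin r′ → Line F
        Lₖ k = A (Fin.suc (Fin.suc (Fin.suc k)))

        us : List (LinearForm F)
        us = List.tabulate (form₁ ∘ Lₖ)

      uₖ-nonzeroOnL₀ : ∀ k → ¬ ¬ (Σ Point λ z → OnLine L₀ z × form₁ (Lₖ k) ∙ z ≉ 0#)
      uₖ-nonzeroOnL₀ k = ¬vanishes⇒nonzeroSomewhere L₀ (form₁ (Lₖ k)) λ uₖ|L₀≈0 →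
        vanishesOnDisjointLines⇒≋0 {Lₖ k} {L₀} (form₁ (Lₖ k)) (disjoint _ _ λ ()) (λ x x∈Lₖ → return (proj₁ x∈Lₖ))
          uₖ|L₀≈0 (form₁≉0 (Lₖ k))

      -- f = Q · u₃ ⋯ u_{r-1}, with Q the quadric through L₀, L₁, L₂ and uₖ a form vanishing on Lₖ.
      module Construction (c₁ c₂ c₃ c₄ d₁ d₂ d₃ d₄ : Carrier)
        (c≋ : form₁ L₁ ≋ combination₄ c₁ c₂ c₃ c₄ (form₁ L₂) (form₂ L₂) (form₁ L₀) (form₂ L₀))
        (d≋ : form₂ L₁ ≋ combination₄ d₁ d₂ d₃ d₄ (form₁ L₂) (form₂ L₂) (form₁ L₀) (form₂ L₀)) where
        open Quadric L₀ L₁ L₂ c₁ c₂ c₃ c₄ d₁ d₂ d₃ d₄ c≋ d≋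

        f : Poly F
        f = Q *ᴾ productOf us

        f-homogeneous : Homogeneous (2 ℕ.+ r′) f
        f-homogeneous = homogeneous-*ₚ Q _ Q-homogeneous
          (≡.subst (λ n → Homogeneous n (productOf us)) (List.length-tabulate _) (homogeneous-product us))

        f∈Iₖ : ∀ k → InLineIdeal F (Lₖ k) f
        f∈Iₖ k = let R , us≃ = productOf-factor us (∈-tabulate⁺ k) in
          inLineIdeal⁺ (Lₖ k) (Q *ᴾ R) 0ᴾ (𝒫.trans (𝒫.*-congˡ {Q} us≃)
            (solveᴾ 4 (λ Q R U V → Q :*ᴾ (R :*ᴾ U) :=ᴾ Q :*ᴾ R :*ᴾ U :+ᴾ (conᴾ 0ℤ :*ᴾ V :+ᴾ conᴾ 0ℤ))
              𝒫.refl Q R (form₁ᴾ (Lₖ k)) (form₂ᴾ (Lₖ k))))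

        f∈I : I_ F A f
        f∈I Fin.zero = inLineIdeal-*ʳ L₀ {Q} Q∈I₀ (productOf us)
        f∈I (Fin.suc Fin.zero) = inLineIdeal-*ʳ L₁ {Q} Q∈I₁ (productOf us)
        f∈I (Fin.suc (Fin.suc Fin.zero)) = inLineIdeal-*ʳ L₂ {Q} Q∈I₂ (productOf us)
        f∈I (Fin.suc (Fin.suc (Fin.suc k))) = f∈Iₖ k

        f-nonzero : ¬ ¬ (Σ Point λ x → eval x f ≉ 0#)
        f-nonzero = do
          (y₀ , Qy₀≉0) ← value-nonzero (disjoint _ _ λ ()) (disjoint _ _ λ ())
          (y , _ , Qy≉0 , us[y]≉0) ← genericPoint {S = λ _ → ⊤} (λ _ _ _ → tt) value-affine us
                                        (All.tabulate⁺ uₖ-nonzeroOnL₀) tt Qy₀≉0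
          return (y , λ f[y]≈0 → *-≉0 Qy≉0 (productAt-≉0 y us us[y]≉0)
            (trans (sym (*-cong (eval-Q y) (eval-productOf y us))) (trans (sym (eval-*ₚ y Q _)) f[y]≈0)))

      nonzeroElementOfDegree<r : ¬ ¬ (Σ (Poly F) λ f → Homogeneous (2 ℕ.+ r′) f × I_ F A f × Σ Point λ x → eval x f ≉ 0#)
      nonzeroElementOfDegree<r = do
        (c₁ , c₂ , c₃ , c₄ , c≋) ← spanning (form₁ L₁)
        (d₁ , d₂ , d₃ , d₄ , d≋) ← spanning (form₂ L₁)
        let open Construction c₁ c₂ c₃ c₄ d₁ d₂ d₃ d₄ c≋ d≋
        (x , f[x]≉0) ← f-nonzero
        return (f , f-homogeneous , f∈I , x , f[x]≉0)
        where
        open Independent₄Forms (form₁ L₂) (form₂ L₂) (form₁ L₀) (form₂ L₀) (disjoint _ _ λ ()) using (spanning)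

proposition5p7 : ∀ {c ℓ} (F : Field c ℓ) → Infinite F →
    (r : ℕ) → 2 < r → (A : Fin r → Line F) →
    (∀ i j → i ≢ j → Disjoint F (A i) (A j)) →
    ¬ GeneratedByProductsOfLinearForms F (I_ F A)
proposition5p7 F inf (suc zero) (ℕ.s≤s ())
proposition5p7 F inf (suc (suc zero)) (ℕ.s≤s (ℕ.s≤s ()))
proposition5p7 F inf (suc (suc (suc r′))) _ A disjoint (gs , gs-products , I⊆⟨gs⟩ , ⟨gs⟩⊆I) = ¬¬⊥⇒⊥ do
  (f , f-homogeneous , f∈I , x , f[x]≉0) ← nonzeroElementOfDegree<r
  gs-order ← ¬¬-All (All.zipWith (λ {g} (g-product , g∈I) → productInI⇒orderAtLeast inf A disjoint {g} g-product g∈I)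
                                 (gs-products , All.map (λ {g} → ⟨gs⟩⊆I g) (generators∈ideal gs)))
  let f-order = orderAtLeast-ideal gs f gs-order (I⊆⟨gs⟩ f f∈I)
  return (f[x]≉0 (eval-≃0 x f (homogeneous∧orderAtLeast⇒≃0 f f-homogeneous f-order)))
  where
  open Polynomials F using (eval-≃0; homogeneous∧orderAtLeast⇒≃0; orderAtLeast-ideal)
  open LineIdeals F
  open Witness inf r′ A disjoint using (nonzeroElementOfDegree<r)
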